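{- None of the following graphs is realizable: $K_5$; $K_{3,2}$; $K_7\setminus C_5$; $K_7\setminus H_6$; $K_8\setminus H_7$.
   Context: Every directed line in $\mathbb{R}^3$ can be written $L=\mathbb{R}x+y$ with $x$ a unit vector (its direction) and $y\in\mathbb{R}^3$. For two non-parallel directed lines $L=\mathbb{R}x+y$, $L'=\mathbb{R}x'+y'$ that are not coplanar, their chirality is $\varepsilon(L,L')=\operatorname{sign}\langle x\times x',\,y-y'\rangle\in\{\pm1\}$ (this is independent of the choice of base points and symmetric in $L,L'$). A finite simple graph $G$ is called realizable if there exist directed lines $\{L_v\}_{v\in V(G)}$ in $\mathbb{R}^3$ such that no two of them are parallel, the distance between any two distinct lines is exactly $1$, and for distinct $v,w$, $\varepsilon(L_v,L_w)=+1$ if and only if $vw\in E(G)$. $C_5$ is the 5-cycle. $H_6$ is the graph on vertices $1,\dots,6$ with edges $12,23,34,45,51,26,56$. $H_7$ is the graph on vertices $1,\dots,7$ with edges $12,23,31,14,25,36,47,57,67$. For a graph $H$ on $m\le n$ vertices, $K_n\setminus H$ denotes the graph on $n$ vertices obtained from the complete graph $K_n$ by identifying $V(H)$ with $m$ of its vertices and deleting the edges of $H$. $K_{3,2}$ is the complete bipartite graph with parts of sizes 3 and 2. -}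

module Defs where

open import Data.Nat as ℕ using (ℕ; _≡ᵇ_)
open import Data.Bool using (Bool; true; false; _∨_; _∧_; not)
open import Data.Fin using (Fin; toℕ)
open import Data.List using (List; []; _∷_)
open import Data.Bool.ListAction using (any)
open import Data.Product using (_×_; _,_; Σ; ∃; ∃-syntax; proj₁; proj₂)
open import Data.Sum using (_⊎_)
open import Relation.Binary.PropositionalEquality using (_≡_)
open import Relation.Nullary using (¬_)
open import Function.Bundles using (_⇔_)

-- The real numbers, axiomatised as a Dedekind-complete ordered field.
-- (agda-stdlib has no reals; every model of this record is isomorphic
-- to ℝ, so quantifying over all models is the same as speaking of ℝ.)

record RealField : Set₁ where
  infixl 6 _+_ _-_
  infixl 7 _*_
  infix  4 _<_ _≤_
  field
    ℝ    : Set
    0r 1r : ℝ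
    _+_ _*_ : ℝ → ℝ → ℝ
    -_   : ℝ → ℝ
    _<_  : ℝ → ℝ → Set
    +-assoc : ∀ a b c → (a + b) + c ≡ a + (b + c)
    +-comm  : ∀ a b → a + b ≡ b + a
    +-identityˡ : ∀ a → 0r + a ≡ a
    -‿inverseˡ : ∀ a → (- a) + a ≡ 0r
    *-assoc : ∀ a b c → (a * b) * c ≡ a * (b * c)
    *-comm  : ∀ a b → a * b ≡ b * a
    *-identityˡ : ∀ a → 1r * a ≡ a
    distribˡ : ∀ a b c → a * (b + c) ≡ a * b + a * c
    0≢1 : ¬ (0r ≡ 1r)
    inverse : ∀ a → ¬ (a ≡ 0r) → ∃[ b ] (a * b ≡ 1r)
    <-irrefl : ∀ a → ¬ (a < a)
    <-trans  : ∀ {a b c} → a < b → b < c → a < c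
    <-tri    : ∀ a b → (a < b) ⊎ (a ≡ b) ⊎ (b < a)
    +-mono-< : ∀ {a b} c → a < b → a + c < b + c
    *-pos    : ∀ {a b} → 0r < a → 0r < b → 0r < a * b
    complete : (S : ℝ → Set) → ∃[ s ] S s → ∃[ u ] (∀ s → S s → (s < u) ⊎ (s ≡ u)) →
               ∃[ l ] ((∀ s → S s → (s < l) ⊎ (s ≡ l)) ×
                       (∀ u → (∀ s → S s → (s < u) ⊎ (s ≡ u)) → (l < u) ⊎ (l ≡ u)))

  _-_ : ℝ → ℝ → ℝ
  a - b = a + (- b)

  _≤_ : ℝ → ℝ → Set
  a ≤ b = (a < b) ⊎ (a ≡ b)

module Geometry (R : RealField) where
  open RealField R

  record V3 : Set where
    constructor ⟨_,_,_⟩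
    field
      c₁ c₂ c₃ : ℝ
  open V3

  _·_ : V3 → V3 → ℝ
  u · v = c₁ u * c₁ v + c₂ u * c₂ v + c₃ u * c₃ v

  _×ᵥ_ : V3 → V3 → V3
  u ×ᵥ v = ⟨ c₂ u * c₃ v - c₃ u * c₂ v
           , c₃ u * c₁ v - c₁ u * c₃ v
           , c₁ u * c₂ v - c₂ u * c₁ v ⟩

  _−ᵥ_ : V3 → V3 → V3
  u −ᵥ v = ⟨ c₁ u - c₁ v , c₂ u - c₂ v , c₃ u - c₃ v ⟩

  0ᵥ : V3
  0ᵥ = ⟨ 0r , 0r , 0r ⟩

  -- A directed line ℝx + y with x a unit vector.
  record DLine : Set where
    constructor line
    field
      dir  : V3
      base : V3
      unit : dir · dir ≡ 1r
  open DLine public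

  Parallel : DLine → DLine → Set
  Parallel L L' = dir L ×ᵥ dir L' ≡ 0ᵥ

  -- ⟨x × x', y − y'⟩ ; lines are coplanar (given non-parallel) iff it is 0,
  -- and the chirality ε(L,L') is its sign.
  triple : DLine → DLine → ℝ
  triple L L' = (dir L ×ᵥ dir L') · (base L −ᵥ base L')

  -- For non-parallel lines the distance is |⟨x×x', y−y'⟩| / |x×x'|;
  -- "distance = 1" is stated in squared form.
  Distance1 : DLine → DLine → Set
  Distance1 L L' = triple L L' * triple L L' ≡ (dir L ×ᵥ dir L') · (dir L ×ᵥ dir L')

  NonCoplanar : DLine → DLine → Set
  NonCoplanar L L' = ¬ (triple L L' ≡ 0r)

  ChiralityPlus : DLine → DLine → Set
  ChiralityPlus L L' = 0r < triple L L'

-- Finite simple graphs on vertex set Fin n, given by an adjacency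
-- function.  Only the values adj v w for v ≢ w are ever consulted, and all
-- concrete graphs below are symmetric by construction.

Realizable : RealField → (n : ℕ) → (Fin n → Fin n → Bool) → Set
Realizable R n adj =
  Σ (Fin n → DLine) λ L →
           (∀ v w → ¬ (v ≡ w) → ¬ Parallel (L v) (L w))
         × (∀ v w → ¬ (v ≡ w) → NonCoplanar (L v) (L w))
         × (∀ v w → ¬ (v ≡ w) → Distance1 (L v) (L w))
         × (∀ v w → ¬ (v ≡ w) → (ChiralityPlus (L v) (L w) ⇔ (adj v w ≡ true)))
  where open Geometry R

-- Concrete graphs.  Vertices are labelled 1..n as in the paper;
-- vertex i corresponds to (i − 1 : Fin n).

label : ∀ {n} → Fin n → ℕ
label v = ℕ.suc (toℕ v)

hasEdge : List (ℕ × ℕ) → ℕ → ℕ → Bool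
hasEdge es a b = any (λ e → ((proj₁ e ≡ᵇ a) ∧ (proj₂ e ≡ᵇ b)) ∨ ((proj₁ e ≡ᵇ b) ∧ (proj₂ e ≡ᵇ a))) es

fromEdges : (n : ℕ) → List (ℕ × ℕ) → Fin n → Fin n → Bool
fromEdges n es v w = hasEdge es (label v) (label w)

minusGraph : (n : ℕ) → List (ℕ × ℕ) → Fin n → Fin n → Bool
minusGraph n es v w = not (hasEdge es (label v) (label w))

C5-edges : List (ℕ × ℕ)
C5-edges = (1 , 2) ∷ (2 , 3) ∷ (3 , 4) ∷ (4 , 5) ∷ (5 , 1) ∷ []

H6-edges : List (ℕ × ℕ)
H6-edges = (1 , 2) ∷ (2 , 3) ∷ (3 , 4) ∷ (4 , 5) ∷ (5 , 1) ∷ (2 , 6) ∷ (5 , 6) ∷ []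

H7-edges : List (ℕ × ℕ)
H7-edges = (1 , 2) ∷ (2 , 3) ∷ (3 , 1) ∷ (1 , 4) ∷ (2 , 5) ∷ (3 , 6)
         ∷ (4 , 7) ∷ (5 , 7) ∷ (6 , 7) ∷ []

K32-edges : List (ℕ × ℕ)
K32-edges = (1 , 4) ∷ (1 , 5) ∷ (2 , 4) ∷ (2 , 5) ∷ (3 , 4) ∷ (3 , 5) ∷ []

K5 : Fin 5 → Fin 5 → Bool
K5 = minusGraph 5 []

K32 : Fin 5 → Fin 5 → Bool
K32 = fromEdges 5 K32-edges

K7∖C5 : Fin 7 → Fin 7 → Bool
K7∖C5 = minusGraph 7 C5-edges

K7∖H6 : Fin 7 → Fin 7 → Bool
K7∖H6 = minusGraph 7 H6-edges

K8∖H7 : Fin 8 → Fin 8 → Bool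
K8∖H7 = minusGraph 8 H7-edges

{-# OPTIONS --safe #-}
module Submission where

-- Write a line as direction x and moment m = y × x. The triple ⟨x × x′, y − y′⟩ of two
-- lines equals x · m′ + x′ · m, so whenever the directions satisfy Σ nᵢ xᵢ = 0 the
-- weighted triples nᵢ nⱼ ⟨xᵢ × xⱼ, yᵢ − yⱼ⟩ sum to zero, and at mutual distance 1 each
-- of them is ± |nᵢ xᵢ × nⱼ xⱼ|. For three lines this rules out coplanar directions, so
-- the chirotope of the directions (the signs of the 3 × 3 determinants) is uniform.
-- For four lines with the Cramer weights nᵢ = ± det of the other three directions,
-- the vectors nᵢ xᵢ close up, and the triangle inequality shows that the four weighted
-- triples along any 4-cycle of K₄ cannot all have the same sign. With the three-term
-- Grassmann–Plücker relations this is a finite system of sign conditions linking the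
-- chiralities to the chirotope; an exhaustive search over chirotopes, proved sound and
-- evaluated during type checking, shows that it has no solution for the five graphs.

open import Algebra.Bundles using (CommutativeRing)
open import Data.Bool.Base using (Bool; true; false; T; not; _∧_; _∨_; if_then_else_)
open import Data.Empty using (⊥)
open import Data.Fin.Base using (Fin; zero; suc)
open import Data.List.Base as List using (List; []; _∷_; _++_)
open import Data.Nat.Base using (ℕ; zero; suc)
open import Data.Product using (_×_)
open import Data.Product.Base using (_,_; proj₁; proj₂)
open import Data.Sign.Base as Sign using (Sign; opposite)
open import Data.Sum.Base using (inj₁; inj₂)
open import Data.Vec.Base as Vec using (Vec; []; _∷_)
open import Relation.Binary.PropositionalEquality using (_≡_)
open import Relation.Nullary using (¬_)
open import Relation.Nullary.Decidable using (Dec; yes; no; does; ¬?; _×-dec_)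
open import Relation.Nullary.Negation using (contradiction)
open import Defs

module IntegerCoefficients {c ℓ} (R : CommutativeRing c ℓ) where
  open import Algebra.Solver.Ring.AlmostCommutativeRing
    using (fromCommutativeRing; _-Raw-AlmostCommutative⟶_)
  open import Data.Integer.Base as ℤ using (ℤ; +_; -[1+_]; _⊖_)
  import Data.Integer.Properties as ℤ
  import Data.Nat.Base as ℕ
  import Data.Nat.Properties as ℕ
  open import Data.Maybe.Base as Maybe using ()
  open import Relation.Binary.Consequences using (dec⇒weaklyDec)
  import Relation.Binary.PropositionalEquality as ≡
  open CommutativeRing R
  open import Algebra.Definitions.RawMonoid +-rawMonoid using () renaming (_×_ to _×ₙ_)
  open import Algebra.Properties.Monoid.Mult +-monoid using (×-homo-+)
  open import Algebra.Properties.Semiring.Mult semiring using (×1-homo-*)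
  open import Algebra.Properties.Ring ring using (-1*x≈-x)
  open import Algebra.Properties.Group +-group using (ε⁻¹≈ε; ⁻¹-involutive)
  open import Algebra.Properties.AbelianGroup +-abelianGroup using (⁻¹-∙-comm)
  open import Algebra.Properties.CommutativeSemigroup +-commutativeSemigroup
    using () renaming (interchange to +-interchange)
  open import Algebra.Properties.CommutativeSemigroup *-commutativeSemigroup
    using () renaming (interchange to *-interchange)
  open import Relation.Binary.Reasoning.Setoid setoid

  ι : ℤ → Carrier
  ι (+ n)    = n ×ₙ 1#
  ι -[1+ n ] = - (suc n ×ₙ 1#)

  private
    ιₛ : Sign → Carrier
    ιₛ Sign.+ = 1#
    ιₛ Sign.- = - 1#

    ιₛ-homo : ∀ s t → ιₛ (s Sign.* t) ≈ ιₛ s * ιₛ t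
    ιₛ-homo Sign.+ t      = sym (*-identityˡ (ιₛ t))
    ιₛ-homo Sign.- Sign.+ = sym (*-identityʳ (- 1#))
    ιₛ-homo Sign.- Sign.- = begin
      1#           ≈⟨ ⁻¹-involutive 1# ⟨
      - - 1#       ≈⟨ -1*x≈-x (- 1#) ⟨
      - 1# * - 1#  ∎

    ι-◃ : ∀ s n → ι (s ℤ.◃ n) ≈ ιₛ s * (n ×ₙ 1#)
    ι-◃ s      zero    = sym (zeroʳ (ιₛ s))
    ι-◃ Sign.+ (suc n) = sym (*-identityˡ _)
    ι-◃ Sign.- (suc n) = sym (-1*x≈-x _)

    ι-⊖ : ∀ m n → ι (m ⊖ n) ≈ m ×ₙ 1# - n ×ₙ 1#
    ι-⊖ m       zero    = begin
      m ×ₙ 1#       ≈⟨ +-identityʳ _ ⟨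
      m ×ₙ 1# + 0#  ≈⟨ +-congˡ ε⁻¹≈ε ⟨
      m ×ₙ 1# - 0#  ∎
    ι-⊖ zero    (suc n) = sym (+-identityˡ _)
    ι-⊖ (suc m) (suc n) = begin
      ι (suc m ⊖ suc n)                    ≡⟨ ≡.cong ι (ℤ.[1+m]⊖[1+n]≡m⊖n m n) ⟩
      ι (m ⊖ n)                            ≈⟨ ι-⊖ m n ⟩
      m ×ₙ 1# - n ×ₙ 1#                    ≈⟨ +-identityˡ _ ⟨
      0# + (m ×ₙ 1# - n ×ₙ 1#)             ≈⟨ +-congʳ (-‿inverseʳ 1#) ⟨
      (1# - 1#) + (m ×ₙ 1# - n ×ₙ 1#)      ≈⟨ +-interchange 1# (- 1#) (m ×ₙ 1#) (- (n ×ₙ 1#)) ⟩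
      (1# + m ×ₙ 1#) + (- 1# - n ×ₙ 1#)    ≈⟨ +-congˡ (⁻¹-∙-comm 1# (n ×ₙ 1#)) ⟩
      (1# + m ×ₙ 1#) - (1# + n ×ₙ 1#)      ∎

  ι-+ : ∀ i j → ι (i ℤ.+ j) ≈ ι i + ι j
  ι-+ (+ m)    (+ n)    = ×-homo-+ 1# m n
  ι-+ (+ m)    -[1+ n ] = ι-⊖ m (suc n)
  ι-+ -[1+ m ] (+ n)    = trans (ι-⊖ n (suc m)) (+-comm _ _)
  ι-+ -[1+ m ] -[1+ n ] = begin
    - (suc (suc (m ℕ.+ n)) ×ₙ 1#)    ≡⟨ ≡.cong (λ k → - (suc k ×ₙ 1#)) (ℕ.+-suc m n) ⟨
    - ((suc m ℕ.+ suc n) ×ₙ 1#)      ≈⟨ -‿cong (×-homo-+ 1# (suc m) (suc n)) ⟩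
    - (suc m ×ₙ 1# + suc n ×ₙ 1#)    ≈⟨ ⁻¹-∙-comm _ _ ⟨
    - (suc m ×ₙ 1#) - (suc n ×ₙ 1#)  ∎

  ι-* : ∀ i j → ι (i ℤ.* j) ≈ ι i * ι j
  ι-* i j = begin
    ι (i ℤ.* j)
      ≈⟨ ι-◃ (ℤ.sign i Sign.* ℤ.sign j) (ℤ.∣ i ∣ ℕ.* ℤ.∣ j ∣) ⟩
    ιₛ (ℤ.sign i Sign.* ℤ.sign j) * ((ℤ.∣ i ∣ ℕ.* ℤ.∣ j ∣) ×ₙ 1#)
      ≈⟨ *-cong (ιₛ-homo (ℤ.sign i) (ℤ.sign j)) (×1-homo-* ℤ.∣ i ∣ ℤ.∣ j ∣) ⟩
    (ιₛ (ℤ.sign i) * ιₛ (ℤ.sign j)) * ((ℤ.∣ i ∣ ×ₙ 1#) * (ℤ.∣ j ∣ ×ₙ 1#))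
      ≈⟨ *-interchange _ _ _ _ ⟩
    (ιₛ (ℤ.sign i) * (ℤ.∣ i ∣ ×ₙ 1#)) * (ιₛ (ℤ.sign j) * (ℤ.∣ j ∣ ×ₙ 1#))
      ≈⟨ *-cong (ι-◃ (ℤ.sign i) ℤ.∣ i ∣) (ι-◃ (ℤ.sign j) ℤ.∣ j ∣) ⟨
    ι (ℤ.sign i ℤ.◃ ℤ.∣ i ∣) * ι (ℤ.sign j ℤ.◃ ℤ.∣ j ∣)
      ≡⟨ ≡.cong₂ (λ a b → ι a * ι b) (ℤ.◃-inverse i) (ℤ.◃-inverse j) ⟩
    ι i * ι j
      ∎

  ι-neg : ∀ i → ι (ℤ.- i) ≈ - ι i
  ι-neg (+ zero)  = sym ε⁻¹≈ε
  ι-neg (+ suc n) = refl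
  ι-neg -[1+ n ]  = sym (⁻¹-involutive _)

  homomorphism : ℤ.+-*-rawRing -Raw-AlmostCommutative⟶ fromCommutativeRing R
  homomorphism = record
    { ⟦_⟧    = ι
    ; +-homo = ι-+
    ; *-homo = ι-*
    ; -‿homo = ι-neg
    ; 0-homo = refl
    ; 1-homo = +-identityʳ 1#
    }

  open import Algebra.Solver.Ring ℤ.+-*-rawRing (fromCommutativeRing R) homomorphism
    (λ i j → Maybe.map (λ i≡j → reflexive (≡.cong ι i≡j)) (dec⇒weaklyDec ℤ._≟_ i j)) public

module RealFieldProperties (R : RealField) where
  open import Data.Integer.Base using (0ℤ)
  open import Data.Sign.Properties using (s*s≡+)
  open import Relation.Binary.PropositionalEquality
    using (refl; sym; trans; cong; cong₂; subst; isEquivalence; module ≡-Reasoning)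
  open RealField R

  +-identityʳ : ∀ a → a + 0r ≡ a
  +-identityʳ a = trans (+-comm a 0r) (+-identityˡ a)

  -‿inverseʳ : ∀ a → a - a ≡ 0r
  -‿inverseʳ a = trans (+-comm a (- a)) (-‿inverseˡ a)

  *-identityʳ : ∀ a → a * 1r ≡ a
  *-identityʳ a = trans (*-comm a 1r) (*-identityˡ a)

  distribʳ : ∀ a b c → (b + c) * a ≡ b * a + c * a
  distribʳ a b c = trans (*-comm (b + c) a) (trans (distribˡ a b c) (cong₂ _+_ (*-comm a b) (*-comm a c)))

  commutativeRing : CommutativeRing _ _
  commutativeRing = record
    { isCommutativeRing = record
      { isRing = record
        { +-isAbelianGroup = record
          { isGroup = record
            { isMonoid = record
              { isSemigroup = record
                { isMagma = record { isEquivalence = isEquivalence ; ∙-cong = cong₂ _+_ }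
                ; assoc = +-assoc }
              ; identity = +-identityˡ , +-identityʳ }
            ; inverse = -‿inverseˡ , -‿inverseʳ
            ; ⁻¹-cong = cong (λ x → - x) }
          ; comm = +-comm }
        ; *-cong = cong₂ _*_
        ; *-assoc = *-assoc
        ; *-identity = *-identityˡ , *-identityʳ
        ; distrib = distribˡ , distribʳ }
      ; *-comm = *-comm } }

  open CommutativeRing commutativeRing public using (zeroˡ; zeroʳ)
  open IntegerCoefficients commutativeRing public
    using (solve; _:=_; _:+_; _:-_; _:*_; :-_; con; Polynomial)

  <-respˡ-≡ : ∀ {a b c} → a ≡ b → a < c → b < c
  <-respˡ-≡ refl a<c = a<c

  <-respʳ-≡ : ∀ {a b c} → b ≡ c → a < b → a < c
  <-respʳ-≡ refl a<b = a<b

  <⇒≢ : ∀ {a b} → a < b → ¬ (a ≡ b)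
  <⇒≢ {a} a<a refl = <-irrefl a a<a

  <-asym : ∀ {a b} → a < b → ¬ (b < a)
  <-asym {a} a<b b<a = <-irrefl a (<-trans a<b b<a)

  ≤⇒≯ : ∀ {a b} → a ≤ b → ¬ (b < a)
  ≤⇒≯ (inj₁ a<b)  b<a = <-asym a<b b<a
  ≤⇒≯ (inj₂ refl) a<a = <⇒≢ a<a refl

  _≟0 : ∀ x → Dec (x ≡ 0r)
  x ≟0 with <-tri x 0r
  ... | inj₁ x<0        = no (<⇒≢ x<0)
  ... | inj₂ (inj₁ x≡0) = yes x≡0
  ... | inj₂ (inj₂ 0<x) = no (λ x≡0 → <⇒≢ 0<x (sym x≡0))

  <⇒0<- : ∀ {a b} → a < b → 0r < b - a
  <⇒0<- {a} a<b = <-respˡ-≡ (-‿inverseʳ a) (+-mono-< (- a) a<b)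

  0<-⇒< : ∀ {a b} → 0r < b - a → a < b
  0<-⇒< {a} {b} 0<b-a = <-respˡ-≡ (+-identityˡ a)
    (<-respʳ-≡ (solve 2 (λ a b → (b :- a) :+ a := b) refl a b) (+-mono-< a 0<b-a))

  ≤⇒0≤- : ∀ {a b} → a ≤ b → 0r ≤ b - a
  ≤⇒0≤- (inj₁ a<b)        = inj₁ (<⇒0<- a<b)
  ≤⇒0≤- {a} (inj₂ refl) = inj₂ (sym (-‿inverseʳ a))

  0≤-⇒≤ : ∀ {a b} → 0r ≤ b - a → a ≤ b
  0≤-⇒≤ (inj₁ 0<b-a)         = inj₁ (0<-⇒< 0<b-a)
  0≤-⇒≤ {a} {b} (inj₂ 0≡b-a) = inj₂ (begin
    a            ≡⟨ +-identityˡ a ⟨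
    0r + a       ≡⟨ cong (_+ a) 0≡b-a ⟩
    (b - a) + a  ≡⟨ solve 2 (λ a b → (b :- a) :+ a := b) refl a b ⟩
    b            ∎)
    where open ≡-Reasoning

  neg-antimono-< : ∀ {a b} → a < b → - b < - a
  neg-antimono-< {a} {b} a<b =
    0<-⇒< (<-respʳ-≡ (solve 2 (λ a b → b :- a := :- a :- :- b) refl a b) (<⇒0<- a<b))

  0<⇒-<0 : ∀ {x} → 0r < x → - x < 0r
  0<⇒-<0 0<x = <-respʳ-≡ (solve 0 (:- con 0ℤ := con 0ℤ) refl) (neg-antimono-< 0<x)

  <0⇒0<- : ∀ {x} → x < 0r → 0r < - x
  <0⇒0<- x<0 = <-respˡ-≡ (solve 0 (:- con 0ℤ := con 0ℤ) refl) (neg-antimono-< x<0)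

  +-pos : ∀ {a b} → 0r < a → 0r < b → 0r < a + b
  +-pos {a} {b} 0<a 0<b = <-trans 0<b (<-respˡ-≡ (+-identityˡ b) (+-mono-< b 0<a))

  +-nonneg-pos : ∀ {a b} → 0r ≤ a → 0r < b → 0r < a + b
  +-nonneg-pos (inj₁ 0<a)            0<b = +-pos 0<a 0<b
  +-nonneg-pos {b = b} (inj₂ refl) 0<b = <-respʳ-≡ (sym (+-identityˡ b)) 0<b

  +-pos-nonneg : ∀ {a b} → 0r < a → 0r ≤ b → 0r < a + b
  +-pos-nonneg {a} {b} 0<a 0≤b = subst (0r <_) (+-comm b a) (+-nonneg-pos 0≤b 0<a)

  +-nonneg : ∀ {a b} → 0r ≤ a → 0r ≤ b → 0r ≤ a + b
  +-nonneg 0≤a (inj₁ 0<b)        = inj₁ (+-nonneg-pos 0≤a 0<b)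
  +-nonneg {a} 0≤a (inj₂ refl) = subst (0r ≤_) (sym (+-identityʳ a)) 0≤a

  +-mono-≤ : ∀ {a b c d} → a ≤ b → c ≤ d → a + c ≤ b + d
  +-mono-≤ {a} {b} {c} {d} a≤b c≤d = 0≤-⇒≤ (subst (0r ≤_)
    (solve 4 (λ a b c d → (b :- a) :+ (d :- c) := (b :+ d) :- (a :+ c)) refl a b c d)
    (+-nonneg (≤⇒0≤- a≤b) (≤⇒0≤- c≤d)))

  x+x<0⇒x<0 : ∀ {x} → x + x < 0r → x < 0r
  x+x<0⇒x<0 {x} x+x<0 with <-tri x 0r
  ... | inj₁ x<0         = x<0
  ... | inj₂ (inj₁ refl) = contradiction (+-identityˡ 0r) (<⇒≢ x+x<0)
  ... | inj₂ (inj₂ 0<x)  = contradiction (+-pos 0<x 0<x) (<-asym x+x<0)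

  +-inverse-unique : ∀ {a b} → a + b ≡ 0r → b ≡ - a
  +-inverse-unique {a} {b} a+b≡0 = begin
    b              ≡⟨ solve 2 (λ a b → b := :- a :+ (a :+ b)) refl a b ⟩
    - a + (a + b)  ≡⟨ cong (λ x → - a + x) a+b≡0 ⟩
    - a + 0r       ≡⟨ +-identityʳ (- a) ⟩
    - a            ∎
    where open ≡-Reasoning

  *-zero-cancelˡ : ∀ {x y} → ¬ (x ≡ 0r) → x * y ≡ 0r → y ≡ 0r
  *-zero-cancelˡ {x} {y} x≢0 xy≡0 with inverse x x≢0
  ... | x⁻¹ , xx⁻¹≡1 = begin
    y              ≡⟨ *-identityˡ y ⟨
    1r * y         ≡⟨ cong (_* y) xx⁻¹≡1 ⟨
    (x * x⁻¹) * y  ≡⟨ solve 3 (λ x x⁻¹ y → (x :* x⁻¹) :* y := x⁻¹ :* (x :* y)) refl x x⁻¹ y ⟩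
    x⁻¹ * (x * y)  ≡⟨ cong (x⁻¹ *_) xy≡0 ⟩
    x⁻¹ * 0r       ≡⟨ zeroʳ x⁻¹ ⟩
    0r             ∎
    where open ≡-Reasoning

  data HasSign : Sign → ℝ → Set where
    positive : ∀ {x} → 0r < x → HasSign Sign.+ x
    negative : ∀ {x} → x < 0r → HasSign Sign.- x

  positive⁻¹ : ∀ {x} → HasSign Sign.+ x → 0r < x
  positive⁻¹ (positive 0<x) = 0<x

  negative⁻¹ : ∀ {x} → HasSign Sign.- x → x < 0r
  negative⁻¹ (negative x<0) = x<0

  hasSign⇒≢0 : ∀ {s x} → HasSign s x → ¬ (x ≡ 0r)
  hasSign⇒≢0 (positive 0<x) x≡0 = <⇒≢ 0<x (sym x≡0)
  hasSign⇒≢0 (negative x<0) x≡0 = <⇒≢ x<0 x≡0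

  hasSign-resp : ∀ {s x y} → x ≡ y → HasSign s x → HasSign s y
  hasSign-resp refl h = h

  hasSign-opposite : ∀ {s x} → HasSign s x → HasSign (opposite s) (- x)
  hasSign-opposite (positive 0<x) = negative (0<⇒-<0 0<x)
  hasSign-opposite (negative x<0) = positive (<0⇒0<- x<0)

  hasSign-* : ∀ {s t x y} → HasSign s x → HasSign t y → HasSign (s Sign.* t) (x * y)
  hasSign-* (positive 0<x) (positive 0<y) = positive (*-pos 0<x 0<y)
  hasSign-* {x = x} {y} (positive 0<x) (negative y<0) =
    hasSign-resp (solve 2 (λ x y → :- (x :* :- y) := x :* y) refl x y)
                 (negative (0<⇒-<0 (*-pos 0<x (<0⇒0<- y<0))))
  hasSign-* {x = x} {y} (negative x<0) (positive 0<y) =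
    hasSign-resp (solve 2 (λ x y → :- (:- x :* y) := x :* y) refl x y)
                 (negative (0<⇒-<0 (*-pos (<0⇒0<- x<0) 0<y)))
  hasSign-* {x = x} {y} (negative x<0) (negative y<0) =
    hasSign-resp (solve 2 (λ x y → :- x :* :- y := x :* y) refl x y)
                 (positive (*-pos (<0⇒0<- x<0) (<0⇒0<- y<0)))

  hasSign-+ : ∀ {s x y} → HasSign s x → HasSign s y → HasSign s (x + y)
  hasSign-+ (positive 0<x) (positive 0<y) = positive (+-pos 0<x 0<y)
  hasSign-+ {x = x} {y} (negative x<0) (negative y<0) =
    hasSign-resp (solve 2 (λ x y → :- (:- x :+ :- y) := x :+ y) refl x y)
                 (negative (0<⇒-<0 (+-pos (<0⇒0<- x<0) (<0⇒0<- y<0))))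

  -- The sign of 0 is junk (+).
  sign : ℝ → Sign
  sign x with <-tri x 0r
  ... | inj₁ _ = Sign.-
  ... | inj₂ _ = Sign.+

  sign-hasSign : ∀ x → ¬ (x ≡ 0r) → HasSign (sign x) x
  sign-hasSign x x≢0 with <-tri x 0r
  ... | inj₁ x<0        = negative x<0
  ... | inj₂ (inj₁ x≡0) = contradiction x≡0 x≢0
  ... | inj₂ (inj₂ 0<x) = positive 0<x

  square-pos : ∀ {x} → ¬ (x ≡ 0r) → 0r < x * x
  square-pos {x} x≢0 = positive⁻¹ (subst (λ s → HasSign s (x * x)) (s*s≡+ (sign x))
                                         (hasSign-* (sign-hasSign x x≢0) (sign-hasSign x x≢0)))

  square-nonneg : ∀ x → 0r ≤ x * x
  square-nonneg x with x ≟0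
  ... | yes refl = inj₂ (sym (zeroˡ 0r))
  ... | no  x≢0  = inj₁ (square-pos x≢0)

  square-cancel-≤ : ∀ {a b} → 0r < b → a * a ≤ b * b → a ≤ b
  square-cancel-≤ {a} {b} 0<b a²≤b² with <-tri a b
  ... | inj₁ a<b        = inj₁ a<b
  ... | inj₂ (inj₁ a≡b) = inj₂ a≡b
  ... | inj₂ (inj₂ b<a) = contradiction b²<a² (≤⇒≯ a²≤b²)
    where
    b²<a² : b * b < a * a
    b²<a² = 0<-⇒< (subst (0r <_) (solve 2 (λ a b → (a :- b) :* (a :+ b) := a :* a :- b :* b) refl a b)
                          (*-pos (<⇒0<- b<a) (+-pos (<-trans 0<b b<a) 0<b)))

  -- 2xy = (x + y)² − x² − y² = w² − 2K = −K.
  pairwise-product-neg : ∀ {x y w K} → x + y + w ≡ 0r → x * x ≡ K → y * y ≡ K → w * w ≡ K → 0r < K →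
                         x * y < 0r
  pairwise-product-neg {x} {y} {w} {K} sum x²≡K y²≡K w²≡K 0<K =
    x+x<0⇒x<0 (<-respˡ-≡ (sym 2xy≡-K) (0<⇒-<0 0<K))
    where
    open ≡-Reasoning
    2xy≡-K : x * y + x * y ≡ - K
    2xy≡-K = begin
      x * y + x * y
        ≡⟨ solve 3 (λ x y w → x :* y :+ x :* y
                     := (x :+ y :+ w) :* (x :+ y :- w) :- x :* x :- y :* y :+ w :* w) refl x y w ⟩
      (x + y + w) * (x + y - w) - x * x - y * y + w * w
        ≡⟨ cong₂ (λ s t → s * (x + y - w) - t - y * y + w * w) sum x²≡K ⟩
      0r * (x + y - w) - K - y * y + w * w
        ≡⟨ cong₂ (λ s t → 0r * (x + y - w) - K - s + t) y²≡K w²≡K ⟩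
      0r * (x + y - w) - K - K + K
        ≡⟨ solve 2 (λ a k → con 0ℤ :* a :- k :- k :+ k := :- k) refl (x + y - w) K ⟩
      - K
        ∎

  -- Otherwise the three pairwise products would be negative, but their product is a square.
  equal-squares-sum : ∀ {x y z} → x + y + z ≡ 0r → x * x ≡ z * z → y * y ≡ z * z → z ≡ 0r
  equal-squares-sum {x} {y} {z} sum x²≡z² y²≡z² with z ≟0
  ... | yes z≡0 = z≡0
  ... | no  z≢0 = contradiction (<-respˡ-≡ square product<0) (≤⇒≯ (square-nonneg (x * y * z)))
    where
    0<z² = square-pos z≢0
    xy<0 = pairwise-product-neg sum x²≡z² y²≡z² refl 0<z²
    xz<0 = pairwise-product-neg (trans (solve 3 (λ x y z → x :+ z :+ y := x :+ y :+ z) refl x y z) sum)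
                                x²≡z² refl y²≡z² 0<z²
    yz<0 = pairwise-product-neg (trans (solve 3 (λ x y z → y :+ z :+ x := x :+ y :+ z) refl x y z) sum)
                                y²≡z² refl x²≡z² 0<z²
    product<0 : (x * y) * (x * z) * (y * z) < 0r
    product<0 = negative⁻¹ (hasSign-* (hasSign-* (negative xy<0) (negative xz<0)) (negative yz<0))
    square : (x * y) * (x * z) * (y * z) ≡ (x * y * z) * (x * y * z)
    square = solve 3 (λ x y z → (x :* y) :* (x :* z) :* (y :* z) := (x :* y :* z) :* (x :* y :* z)) refl x y z

  -- (2x² + 2y²) − (γ² + δ²) = (x − y)² + 2γδ once x + y = −(γ + δ).
  squares-exceed : ∀ {x y γ δ} → 0r < γ → 0r < δ → x + y + γ + δ ≡ 0r →
                   γ * γ + δ * δ < (x * x + x * x) + (y * y + y * y)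
  squares-exceed {x} {y} {γ} {δ} 0<γ 0<δ sum = 0<-⇒< (subst (0r <_) (sym gap)
    (+-nonneg-pos (square-nonneg (x - y)) (+-pos (*-pos 0<γ 0<δ) (*-pos 0<γ 0<δ))))
    where
    open ≡-Reasoning
    gap : (x * x + x * x) + (y * y + y * y) - (γ * γ + δ * δ) ≡ (x - y) * (x - y) + (γ * δ + γ * δ)
    gap = begin
      (x * x + x * x) + (y * y + y * y) - (γ * γ + δ * δ)
        ≡⟨ solve 4 (λ x y γ δ → (x :* x :+ x :* x) :+ (y :* y :+ y :* y) :- (γ :* γ :+ δ :* δ)
                     := (x :- y) :* (x :- y) :+ (γ :* δ :+ γ :* δ) :+ (x :+ y :+ γ :+ δ) :* (x :+ y :- γ :- δ))
                   refl x y γ δ ⟩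
      (x - y) * (x - y) + (γ * δ + γ * δ) + (x + y + γ + δ) * (x + y - γ - δ)
        ≡⟨ cong (λ s → (x - y) * (x - y) + (γ * δ + γ * δ) + s * (x + y - γ - δ)) sum ⟩
      (x - y) * (x - y) + (γ * δ + γ * δ) + 0r * (x + y - γ - δ)
        ≡⟨ solve 2 (λ a b → a :+ con 0ℤ :* b := a) refl _ (x + y - γ - δ) ⟩
      (x - y) * (x - y) + (γ * δ + γ * δ)
        ∎

module ChirotopeConditions where
  open import Data.Fin.Properties using () renaming (_≟_ to _≟ᶠ_)
  open import Data.Sign.Base using (+; -; _*_)
  open import Data.Sign.Properties using () renaming (_≟_ to _≟ₛ_)
  open import Data.Unit.Base using (⊤; tt)
  open import Data.Vec.Relation.Unary.All as VecAll using ()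

  -- A bracket: an ordered triple of vertices, standing for the determinant of their directions.
  Triple : ℕ → Set
  Triple n = Fin n × Fin n × Fin n

  Constant : ∀ {k} → Vec Sign k → Set
  Constant []       = ⊤
  Constant (s ∷ ss) = VecAll.All (s ≡_) ss

  constant? : ∀ {k} (ss : Vec Sign k) → Dec (Constant ss)
  constant? []       = yes tt
  constant? (s ∷ ss) = VecAll.all? (s ≟ₛ_) ss

  module _ {A : Set} where
    pairSigns : (ε : A → A → Sign) (a b c d : A) (νa νb νc νd : Sign) → Vec Sign 6
    pairSigns ε a b c d νa νb νc νd =
      ε a b * (νa * νb) ∷ ε a c * (νa * νc) ∷ ε a d * (νa * νd) ∷
      ε b c * (νb * νc) ∷ ε b d * (νb * νd) ∷ ε c d * (νc * νd) ∷ []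

    -- For a < b < c < d < e and a pivot p among them, the brackets of the three-term
    -- Grassmann–Plücker relation [pwx][pyz] − [pwy][pxz] + [pwz][pxy] = 0 on p and the
    -- other four points w < x < y < z, each bracket written in increasing order.
    plückerBrackets : Fin 5 → (a b c d e : A) → Vec (A × A × A) 6
    plückerBrackets zero a b c d e =
      (a , b , c) ∷ (a , d , e) ∷ (a , b , d) ∷ (a , c , e) ∷ (a , b , e) ∷ (a , c , d) ∷ []
    plückerBrackets (suc zero) a b c d e =
      (a , b , c) ∷ (b , d , e) ∷ (a , b , d) ∷ (b , c , e) ∷ (a , b , e) ∷ (b , c , d) ∷ []
    plückerBrackets (suc (suc zero)) a b c d e =
      (a , b , c) ∷ (c , d , e) ∷ (a , c , d) ∷ (b , c , e) ∷ (a , c , e) ∷ (b , c , d) ∷ []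
    plückerBrackets (suc (suc (suc zero))) a b c d e =
      (a , b , d) ∷ (c , d , e) ∷ (a , c , d) ∷ (b , d , e) ∷ (a , d , e) ∷ (b , c , d) ∷ []
    plückerBrackets (suc (suc (suc (suc zero)))) a b c d e =
      (a , b , e) ∷ (c , d , e) ∷ (a , c , e) ∷ (b , d , e) ∷ (a , d , e) ∷ (b , c , e) ∷ []

  -- The three 4-cycles of K₄ on a b c d: the complements of the matchings ab|cd, ac|bd, ad|bc.
  fourCycles : Vec Sign 6 → Vec (Vec Sign 4) 3
  fourCycles (sab ∷ sac ∷ sad ∷ sbc ∷ sbd ∷ scd ∷ []) =
    (sac ∷ sad ∷ sbc ∷ sbd ∷ []) ∷ (sab ∷ sad ∷ sbc ∷ scd ∷ []) ∷ (sab ∷ sac ∷ sbd ∷ scd ∷ []) ∷ []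

  plückerTerms : Vec Sign 6 → Vec Sign 3
  plückerTerms (χ₁ ∷ χ₂ ∷ χ₃ ∷ χ₄ ∷ χ₅ ∷ χ₆ ∷ []) = χ₁ * χ₂ ∷ opposite (χ₃ * χ₄) ∷ χ₅ * χ₆ ∷ []

  data Constraint (n : ℕ) : Set where
    quadruple : (a b c d : Fin n) → Constraint n
    plücker   : (pivot : Fin 5) (a b c d e : Fin n) → Constraint n

  module _ {n : ℕ} where
    Distinct : Triple n → Set
    Distinct (i , j , k) = ¬ i ≡ j × ¬ i ≡ k × ¬ j ≡ k

    distinct? : (t : Triple n) → Dec (Distinct t)
    distinct? (i , j , k) = ¬? (i ≟ᶠ j) ×-dec ¬? (i ≟ᶠ k) ×-dec ¬? (j ≟ᶠ k)

    arity : Constraint n → ℕ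
    arity (quadruple _ _ _ _)   = 4
    arity (plücker _ _ _ _ _ _) = 6

    brackets : (c : Constraint n) → Vec (Triple n) (arity c)
    brackets (quadruple a b c d)   = (b , c , d) ∷ (a , c , d) ∷ (a , b , d) ∷ (a , b , c) ∷ []
    brackets (plücker p a b c d e) = plückerBrackets p a b c d e

    -- ε gives the chirality signs and the vector the signs of the brackets; the vertices
    -- of a quadruple get the signs of the Cramer coefficients [bcd], −[acd], [abd], −[abc].
    module _ (ε : Fin n → Fin n → Sign) where
      Satisfies : (c : Constraint n) → Vec Sign (arity c) → Set
      Satisfies (quadruple a b c d) (χbcd ∷ χacd ∷ χabd ∷ χabc ∷ []) =
        VecAll.All (λ cycle → ¬ Constant cycle)
                   (fourCycles (pairSigns ε a b c d χbcd (opposite χacd) χabd (opposite χabc)))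
      Satisfies (plücker _ _ _ _ _ _) χs = ¬ Constant (plückerTerms χs)

      satisfies? : (c : Constraint n) (χs : Vec Sign (arity c)) → Dec (Satisfies c χs)
      satisfies? (quadruple a b c d) (χbcd ∷ χacd ∷ χabd ∷ χabc ∷ []) =
        VecAll.all? (λ cycle → ¬? (constant? cycle))
                    (fourCycles (pairSigns ε a b c d χbcd (opposite χacd) χabd (opposite χabc)))
      satisfies? (plücker _ _ _ _ _ _) χs = ¬? (constant? (plückerTerms χs))

      Admissible : (Triple n → Sign) → Set
      Admissible χ = ∀ c → VecAll.All Distinct (brackets c) → Satisfies c (Vec.map χ (brackets c))

module Vectors (R : RealField) where
  open import Data.Integer.Base using (0ℤ)
  open import Data.Vec.N-ary using (N-ary)
  open import Relation.Binary.PropositionalEquality using (refl; sym; trans; cong; cong₂; subst; module ≡-Reasoning)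
  open ChirotopeConditions using (plückerBrackets)
  open RealField R
  open RealFieldProperties R
  open Geometry R
  open V3

  infixl 6 _+ᵥ_
  infixr 25 _⋆_

  _+ᵥ_ : V3 → V3 → V3
  u +ᵥ v = ⟨ c₁ u + c₁ v , c₂ u + c₂ v , c₃ u + c₃ v ⟩

  -ᵥ_ : V3 → V3
  -ᵥ v = ⟨ - c₁ v , - c₂ v , - c₃ v ⟩

  _⋆_ : ℝ → V3 → V3
  a ⋆ v = ⟨ a * c₁ v , a * c₂ v , a * c₃ v ⟩

  ‖_‖² : V3 → ℝ
  ‖ v ‖² = v · v

  det : V3 → V3 → V3 → ℝ
  det a b c = a · (b ×ᵥ c)

  module _ {k : ℕ} where
    infix  9 _·ₚ_
    infixl 10 _+ₚ_
    infixl 11 _×ₚ_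
    infixr 12 _⋆ₚ_
    infix  13 -ₚ_

    PV : Set
    PV = Polynomial k × Polynomial k × Polynomial k

    _·ₚ_ : PV → PV → Polynomial k
    (a₁ , a₂ , a₃) ·ₚ (b₁ , b₂ , b₃) = a₁ :* b₁ :+ a₂ :* b₂ :+ a₃ :* b₃

    _×ₚ_ : PV → PV → PV
    (a₁ , a₂ , a₃) ×ₚ (b₁ , b₂ , b₃) = (a₂ :* b₃ :- a₃ :* b₂ , a₃ :* b₁ :- a₁ :* b₃ , a₁ :* b₂ :- a₂ :* b₁)

    _+ₚ_ : PV → PV → PV
    (a₁ , a₂ , a₃) +ₚ (b₁ , b₂ , b₃) = (a₁ :+ b₁ , a₂ :+ b₂ , a₃ :+ b₃)

    -ₚ_ : PV → PV
    -ₚ (a₁ , a₂ , a₃) = (:- a₁ , :- a₂ , :- a₃)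

    _⋆ₚ_ : Polynomial k → PV → PV
    s ⋆ₚ (a₁ , a₂ , a₃) = (s :* a₁ , s :* a₂ , s :* a₃)

  ⟨⟩-cong : ∀ {a b c a′ b′ c′} → a ≡ a′ → b ≡ b′ → c ≡ c′ → ⟨ a , b , c ⟩ ≡ ⟨ a′ , b′ , c′ ⟩
  ⟨⟩-cong refl refl refl = refl

  +ᵥ-swapʳ : ∀ u v w → u +ᵥ v +ᵥ w ≡ u +ᵥ w +ᵥ v
  +ᵥ-swapʳ u v w = ⟨⟩-cong (swap (c₁ u) (c₁ v) (c₁ w)) (swap (c₂ u) (c₂ v) (c₂ w)) (swap (c₃ u) (c₃ v) (c₃ w))
    where
    swap : ∀ x y z → x + y + z ≡ x + z + y
    swap = solve 3 (λ x y z → x :+ y :+ z := x :+ z :+ y) refl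

  +ᵥ-0⋆ : ∀ v u → v +ᵥ 0r ⋆ u ≡ v
  +ᵥ-0⋆ v u = ⟨⟩-cong (drop (c₁ v) (c₁ u)) (drop (c₂ v) (c₂ u)) (drop (c₃ v) (c₃ u))
    where
    drop : ∀ x y → x + 0r * y ≡ x
    drop = solve 2 (λ x y → x :+ con 0ℤ :* y := x) refl

  -0⋆ : ∀ v → (- 0r) ⋆ v ≡ 0ᵥ
  -0⋆ v = ⟨⟩-cong (vanish (c₁ v)) (vanish (c₂ v)) (vanish (c₃ v))
    where
    vanish : ∀ x → - 0r * x ≡ 0r
    vanish = solve 1 (λ x → :- con 0ℤ :* x := con 0ℤ) refl

  +ᵥ-inverse-unique : ∀ {u v} → u +ᵥ v ≡ 0ᵥ → v ≡ -ᵥ u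
  +ᵥ-inverse-unique u+v≡0 = ⟨⟩-cong (+-inverse-unique (cong c₁ u+v≡0)) (+-inverse-unique (cong c₂ u+v≡0))
                                    (+-inverse-unique (cong c₃ u+v≡0))

  ·-zeroˡ : ∀ v → 0ᵥ · v ≡ 0r
  ·-zeroˡ v = solve 3 (λ x y z → con 0ℤ :* x :+ con 0ℤ :* y :+ con 0ℤ :* z := con 0ℤ) refl (c₁ v) (c₂ v) (c₃ v)

  ‖‖²-nonneg : ∀ v → 0r ≤ ‖ v ‖²
  ‖‖²-nonneg v = +-nonneg (+-nonneg (square-nonneg (c₁ v)) (square-nonneg (c₂ v))) (square-nonneg (c₃ v))

  ‖‖²-pos : ∀ v → ¬ (v ≡ 0ᵥ) → 0r < ‖ v ‖²
  ‖‖²-pos ⟨ a , b , c ⟩ v≢0 with a ≟0 | b ≟0 | c ≟0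
  ... | yes refl | yes refl | yes refl = contradiction refl v≢0
  ... | no a≢0   | _        | _      =
    +-pos-nonneg (+-pos-nonneg (square-pos a≢0) (square-nonneg b)) (square-nonneg c)
  ... | yes _    | no b≢0   | _      =
    +-pos-nonneg (+-nonneg-pos (square-nonneg a) (square-pos b≢0)) (square-nonneg c)
  ... | yes _    | yes _    | no c≢0 =
    +-nonneg-pos (+-nonneg (square-nonneg a) (square-nonneg b)) (square-pos c≢0)

  ‖×‖²-comm : ∀ a b → ‖ a ×ᵥ b ‖² ≡ ‖ b ×ᵥ a ‖²
  ‖×‖²-comm a b = solve 6 (λ a₁ a₂ a₃ b₁ b₂ b₃ → let A = a₁ , a₂ , a₃ ; B = b₁ , b₂ , b₃ in
    (A ×ₚ B) ·ₚ (A ×ₚ B) := (B ×ₚ A) ·ₚ (B ×ₚ A)) refl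
    (c₁ a) (c₂ a) (c₃ a) (c₁ b) (c₂ b) (c₃ b)

  ‖⋆×⋆‖² : ∀ s t a b → ‖ s ⋆ a ×ᵥ t ⋆ b ‖² ≡ (s * t) * (s * t) * ‖ a ×ᵥ b ‖²
  ‖⋆×⋆‖² s t a b = solve 8 (λ s t a₁ a₂ a₃ b₁ b₂ b₃ → let A = a₁ , a₂ , a₃ ; B = b₁ , b₂ , b₃ in
    (s ⋆ₚ A ×ₚ t ⋆ₚ B) ·ₚ (s ⋆ₚ A ×ₚ t ⋆ₚ B) := (s :* t) :* (s :* t) :* (A ×ₚ B) ·ₚ (A ×ₚ B)) refl
    s t (c₁ a) (c₂ a) (c₃ a) (c₁ b) (c₂ b) (c₃ b)

  lagrange : ∀ a b → ‖ a ‖² * ‖ b ‖² ≡ (a · b) * (a · b) + ‖ a ×ᵥ b ‖²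
  lagrange a b = solve 6 (λ a₁ a₂ a₃ b₁ b₂ b₃ → let A = a₁ , a₂ , a₃ ; B = b₁ , b₂ , b₃ in
    (A ·ₚ A) :* (B ·ₚ B) := (A ·ₚ B) :* (A ·ₚ B) :+ (A ×ₚ B) ·ₚ (A ×ₚ B)) refl
    (c₁ a) (c₂ a) (c₃ a) (c₁ b) (c₂ b) (c₃ b)

  cauchy-schwarz : ∀ {a b q r} → 0r < q → 0r < r → q * q ≡ ‖ a ‖² → r * r ≡ ‖ b ‖² → a · b ≤ q * r
  cauchy-schwarz {a} {b} {q} {r} 0<q 0<r q²≡ r²≡ =
    square-cancel-≤ (*-pos 0<q 0<r) (0≤-⇒≤ (subst (0r ≤_) (sym gap) (‖‖²-nonneg (a ×ᵥ b))))
    where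
    open ≡-Reasoning
    gap : (q * r) * (q * r) - (a · b) * (a · b) ≡ ‖ a ×ᵥ b ‖²
    gap = begin
      (q * r) * (q * r) - (a · b) * (a · b)
        ≡⟨ cong (_- (a · b) * (a · b)) (solve 2 (λ q r → (q :* r) :* (q :* r) := (q :* q) :* (r :* r)) refl q r) ⟩
      (q * q) * (r * r) - (a · b) * (a · b)
        ≡⟨ cong₂ (λ x y → x * y - (a · b) * (a · b)) q²≡ r²≡ ⟩
      ‖ a ‖² * ‖ b ‖² - (a · b) * (a · b)
        ≡⟨ cong (_- (a · b) * (a · b)) (lagrange a b) ⟩
      ((a · b) * (a · b) + ‖ a ×ᵥ b ‖²) - (a · b) * (a · b)
        ≡⟨ solve 2 (λ x y → (x :+ y) :- x := y) refl _ _ ⟩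
      ‖ a ×ᵥ b ‖²
        ∎

  triangle : ∀ {a b q r} → 0r < q → 0r < r → q * q ≡ ‖ a ‖² → r * r ≡ ‖ b ‖² → ‖ a +ᵥ b ‖² ≤ (q + r) * (q + r)
  triangle {a} {b} {q} {r} 0<q 0<r q²≡ r²≡ = 0≤-⇒≤ (subst (0r ≤_) (sym gap) (+-nonneg d d))
    where
    open ≡-Reasoning
    d : 0r ≤ q * r - a · b
    d = ≤⇒0≤- (cauchy-schwarz 0<q 0<r q²≡ r²≡)
    gap : (q + r) * (q + r) - ‖ a +ᵥ b ‖² ≡ (q * r - a · b) + (q * r - a · b)
    gap = begin
      (q + r) * (q + r) - ‖ a +ᵥ b ‖²
        ≡⟨ solve 8 (λ q r a₁ a₂ a₃ b₁ b₂ b₃ → let A = a₁ , a₂ , a₃ ; B = b₁ , b₂ , b₃ in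
             (q :+ r) :* (q :+ r) :- (A +ₚ B) ·ₚ (A +ₚ B)
             := (q :* q :- A ·ₚ A) :+ (r :* r :- B ·ₚ B) :+ ((q :* r :- A ·ₚ B) :+ (q :* r :- A ·ₚ B))) refl
             q r (c₁ a) (c₂ a) (c₃ a) (c₁ b) (c₂ b) (c₃ b) ⟩
      (q * q - ‖ a ‖²) + (r * r - ‖ b ‖²) + ((q * r - a · b) + (q * r - a · b))
        ≡⟨ cong₂ (λ x y → (x - ‖ a ‖²) + (y - ‖ b ‖²) + ((q * r - a · b) + (q * r - a · b))) q²≡ r²≡ ⟩
      (‖ a ‖² - ‖ a ‖²) + (‖ b ‖² - ‖ b ‖²) + ((q * r - a · b) + (q * r - a · b))
        ≡⟨ solve 3 (λ x y z → (x :- x) :+ (y :- y) :+ z := z) refl _ _ _ ⟩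
      (q * r - a · b) + (q * r - a · b)
        ∎

  -- If a + b + c = 0 then a × c = b × a and b × c = a × b.
  closed-triangle : ∀ a b c → a +ᵥ b +ᵥ c ≡ 0ᵥ → ‖ a ×ᵥ c ‖² ≡ ‖ a ×ᵥ b ‖² × ‖ b ×ᵥ c ‖² ≡ ‖ a ×ᵥ b ‖²
  closed-triangle a b c closed =
    trans (cong (λ c → ‖ a ×ᵥ c ‖²) (+ᵥ-inverse-unique closed))
      (solve 6 (λ a₁ a₂ a₃ b₁ b₂ b₃ → let A = a₁ , a₂ , a₃ ; B = b₁ , b₂ , b₃ in
         (A ×ₚ -ₚ (A +ₚ B)) ·ₚ (A ×ₚ -ₚ (A +ₚ B)) := (A ×ₚ B) ·ₚ (A ×ₚ B)) refl
         (c₁ a) (c₂ a) (c₃ a) (c₁ b) (c₂ b) (c₃ b)) ,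
    trans (cong (λ c → ‖ b ×ᵥ c ‖²) (+ᵥ-inverse-unique closed))
      (solve 6 (λ a₁ a₂ a₃ b₁ b₂ b₃ → let A = a₁ , a₂ , a₃ ; B = b₁ , b₂ , b₃ in
         (B ×ₚ -ₚ (A +ₚ B)) ·ₚ (B ×ₚ -ₚ (A +ₚ B)) := (A ×ₚ B) ·ₚ (A ×ₚ B)) refl
         (c₁ a) (c₂ a) (c₃ a) (c₁ b) (c₂ b) (c₃ b))

  diagonals : ∀ a b c →
    let d = -ᵥ (a +ᵥ b +ᵥ c) in
    ‖ b ×ᵥ c +ᵥ d ×ᵥ a ‖² + ‖ b ×ᵥ d +ᵥ c ×ᵥ a ‖² ≡ (‖ a ×ᵥ b ‖² + ‖ a ×ᵥ b ‖²) + (‖ c ×ᵥ d ‖² + ‖ c ×ᵥ d ‖²)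
  diagonals a b c = solve 9 (λ a₁ a₂ a₃ b₁ b₂ b₃ c₁ c₂ c₃ →
    let A = a₁ , a₂ , a₃ ; B = b₁ , b₂ , b₃ ; C = c₁ , c₂ , c₃ ; D = -ₚ (A +ₚ B +ₚ C) in
    (B ×ₚ C +ₚ D ×ₚ A) ·ₚ (B ×ₚ C +ₚ D ×ₚ A) :+ (B ×ₚ D +ₚ C ×ₚ A) ·ₚ (B ×ₚ D +ₚ C ×ₚ A)
    := ((A ×ₚ B) ·ₚ (A ×ₚ B) :+ (A ×ₚ B) ·ₚ (A ×ₚ B)) :+ ((C ×ₚ D) ·ₚ (C ×ₚ D) :+ (C ×ₚ D) ·ₚ (C ×ₚ D))) refl
    (c₁ a) (c₂ a) (c₃ a) (c₁ b) (c₂ b) (c₃ b) (c₁ c) (c₂ c) (c₃ c)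

  cramer : ∀ a b c d → det b c d ⋆ a +ᵥ (- det a c d) ⋆ b +ᵥ det a b d ⋆ c +ᵥ (- det a b c) ⋆ d ≡ 0ᵥ
  cramer a b c d = ⟨⟩-cong
    (solve 12 (λ a₁ a₂ a₃ b₁ b₂ b₃ c₁ c₂ c₃ d₁ d₂ d₃ →
       let A = a₁ , a₂ , a₃ ; B = b₁ , b₂ , b₃ ; C = c₁ , c₂ , c₃ ; D = d₁ , d₂ , d₃ in
       B ·ₚ (C ×ₚ D) :* a₁ :+ :- (A ·ₚ (C ×ₚ D)) :* b₁ :+ A ·ₚ (B ×ₚ D) :* c₁ :+ :- (A ·ₚ (B ×ₚ C)) :* d₁
       := con 0ℤ) refl (c₁ a) (c₂ a) (c₃ a) (c₁ b) (c₂ b) (c₃ b) (c₁ c) (c₂ c) (c₃ c) (c₁ d) (c₂ d) (c₃ d))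
    (solve 12 (λ a₁ a₂ a₃ b₁ b₂ b₃ c₁ c₂ c₃ d₁ d₂ d₃ →
       let A = a₁ , a₂ , a₃ ; B = b₁ , b₂ , b₃ ; C = c₁ , c₂ , c₃ ; D = d₁ , d₂ , d₃ in
       B ·ₚ (C ×ₚ D) :* a₂ :+ :- (A ·ₚ (C ×ₚ D)) :* b₂ :+ A ·ₚ (B ×ₚ D) :* c₂ :+ :- (A ·ₚ (B ×ₚ C)) :* d₂
       := con 0ℤ) refl (c₁ a) (c₂ a) (c₃ a) (c₁ b) (c₂ b) (c₃ b) (c₁ c) (c₂ c) (c₃ c) (c₁ d) (c₂ d) (c₃ d))
    (solve 12 (λ a₁ a₂ a₃ b₁ b₂ b₃ c₁ c₂ c₃ d₁ d₂ d₃ →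
       let A = a₁ , a₂ , a₃ ; B = b₁ , b₂ , b₃ ; C = c₁ , c₂ , c₃ ; D = d₁ , d₂ , d₃ in
       B ·ₚ (C ×ₚ D) :* a₃ :+ :- (A ·ₚ (C ×ₚ D)) :* b₃ :+ A ·ₚ (B ×ₚ D) :* c₃ :+ :- (A ·ₚ (B ×ₚ C)) :* d₃
       := con 0ℤ) refl (c₁ a) (c₂ a) (c₃ a) (c₁ b) (c₂ b) (c₃ b) (c₁ c) (c₂ c) (c₃ c) (c₁ d) (c₂ d) (c₃ d))

  dependency : ∀ a b c →
    ((c ×ᵥ b) · (a ×ᵥ b)) ⋆ a +ᵥ ((a ×ᵥ c) · (a ×ᵥ b)) ⋆ b +ᵥ (- ‖ a ×ᵥ b ‖²) ⋆ c ≡ (- det a b c) ⋆ (a ×ᵥ b)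
  dependency a b c = ⟨⟩-cong
    (solve 9 (λ a₁ a₂ a₃ b₁ b₂ b₃ c₁ c₂ c₃ →
       let A = a₁ , a₂ , a₃ ; B = b₁ , b₂ , b₃ ; C = c₁ , c₂ , c₃ ; W = A ×ₚ B in
       (C ×ₚ B) ·ₚ W :* a₁ :+ (A ×ₚ C) ·ₚ W :* b₁ :+ :- (W ·ₚ W) :* c₁ := :- (A ·ₚ (B ×ₚ C)) :* proj₁ W) refl
       (c₁ a) (c₂ a) (c₃ a) (c₁ b) (c₂ b) (c₃ b) (c₁ c) (c₂ c) (c₃ c))
    (solve 9 (λ a₁ a₂ a₃ b₁ b₂ b₃ c₁ c₂ c₃ →
       let A = a₁ , a₂ , a₃ ; B = b₁ , b₂ , b₃ ; C = c₁ , c₂ , c₃ ; W = A ×ₚ B in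
       (C ×ₚ B) ·ₚ W :* a₂ :+ (A ×ₚ C) ·ₚ W :* b₂ :+ :- (W ·ₚ W) :* c₂
       := :- (A ·ₚ (B ×ₚ C)) :* proj₁ (proj₂ W)) refl
       (c₁ a) (c₂ a) (c₃ a) (c₁ b) (c₂ b) (c₃ b) (c₁ c) (c₂ c) (c₃ c))
    (solve 9 (λ a₁ a₂ a₃ b₁ b₂ b₃ c₁ c₂ c₃ →
       let A = a₁ , a₂ , a₃ ; B = b₁ , b₂ , b₃ ; C = c₁ , c₂ , c₃ ; W = A ×ₚ B in
       (C ×ₚ B) ·ₚ W :* a₃ :+ (A ×ₚ C) ·ₚ W :* b₃ :+ :- (W ·ₚ W) :* c₃
       := :- (A ·ₚ (B ×ₚ C)) :* proj₂ (proj₂ W)) refl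
       (c₁ a) (c₂ a) (c₃ a) (c₁ b) (c₂ b) (c₃ b) (c₁ c) (c₂ c) (c₃ c))

  det₃ : V3 × V3 × V3 → ℝ
  det₃ (a , b , c) = det a b c

  plückerSum : Vec ℝ 6 → ℝ
  plückerSum (y₁ ∷ y₂ ∷ y₃ ∷ y₄ ∷ y₅ ∷ y₆ ∷ []) = y₁ * y₂ - y₃ * y₄ + y₅ * y₆

  private
    plückerEquation : Fin 5 → N-ary 15 (Polynomial 15) (Polynomial 15 × Polynomial 15)
    plückerEquation p a₁ a₂ a₃ b₁ b₂ b₃ c₁ c₂ c₃ d₁ d₂ d₃ e₁ e₂ e₃ =
      sumₚ (Vec.map detₚ (plückerBrackets p (a₁ , a₂ , a₃) (b₁ , b₂ , b₃) (c₁ , c₂ , c₃)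
                                             (d₁ , d₂ , d₃) (e₁ , e₂ , e₃)))
      := con 0ℤ
      where
      detₚ : PV × PV × PV → Polynomial 15
      detₚ (x , y , z) = x ·ₚ (y ×ₚ z)
      sumₚ : Vec (Polynomial 15) 6 → Polynomial 15
      sumₚ (y₁ ∷ y₂ ∷ y₃ ∷ y₄ ∷ y₅ ∷ y₆ ∷ []) = y₁ :* y₂ :- y₃ :* y₄ :+ y₅ :* y₆

  grassmann-plücker : ∀ p a b c d e → plückerSum (Vec.map det₃ (plückerBrackets p a b c d e)) ≡ 0r
  grassmann-plücker zero a b c d e = solve 15 (plückerEquation zero) refl
    (c₁ a) (c₂ a) (c₃ a) (c₁ b) (c₂ b) (c₃ b) (c₁ c) (c₂ c) (c₃ c) (c₁ d) (c₂ d) (c₃ d) (c₁ e) (c₂ e) (c₃ e)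
  grassmann-plücker (suc zero) a b c d e = solve 15 (plückerEquation (suc zero)) refl
    (c₁ a) (c₂ a) (c₃ a) (c₁ b) (c₂ b) (c₃ b) (c₁ c) (c₂ c) (c₃ c) (c₁ d) (c₂ d) (c₃ d) (c₁ e) (c₂ e) (c₃ e)
  grassmann-plücker (suc (suc zero)) a b c d e = solve 15 (plückerEquation (suc (suc zero))) refl
    (c₁ a) (c₂ a) (c₃ a) (c₁ b) (c₂ b) (c₃ b) (c₁ c) (c₂ c) (c₃ c) (c₁ d) (c₂ d) (c₃ d) (c₁ e) (c₂ e) (c₃ e)
  grassmann-plücker (suc (suc (suc zero))) a b c d e = solve 15 (plückerEquation (suc (suc (suc zero)))) refl
    (c₁ a) (c₂ a) (c₃ a) (c₁ b) (c₂ b) (c₃ b) (c₁ c) (c₂ c) (c₃ c) (c₁ d) (c₂ d) (c₃ d) (c₁ e) (c₂ e) (c₃ e)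
  grassmann-plücker (suc (suc (suc (suc zero)))) a b c d e =
    solve 15 (plückerEquation (suc (suc (suc (suc zero))))) refl
    (c₁ a) (c₂ a) (c₃ a) (c₁ b) (c₂ b) (c₃ b) (c₁ c) (c₂ c) (c₃ c) (c₁ d) (c₂ d) (c₃ d) (c₁ e) (c₂ e) (c₃ e)

module ClosedQuadrilaterals (R : RealField) where
  open import Data.Integer.Base using (0ℤ)
  open import Relation.Binary.PropositionalEquality using (refl; trans; cong; cong₂; subst; module ≡-Reasoning)
  open import Data.Vec.Relation.Unary.All as VecAll using ([]; _∷_)
  open ChirotopeConditions using (Constant; fourCycles)
  open RealField R
  open RealFieldProperties R
  open Geometry R
  open Vectors R

  record ClosedQuadrilateral : Set where
    field
      v₁ v₂ v₃ v₄ : V3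
      u₁₂ u₁₃ u₁₄ u₂₃ u₂₄ u₃₄ : ℝ
      closed   : v₁ +ᵥ v₂ +ᵥ v₃ +ᵥ v₄ ≡ 0ᵥ
      balanced : u₁₂ + u₁₃ + u₁₄ + u₂₃ + u₂₄ + u₃₄ ≡ 0r
      u₁₂² : u₁₂ * u₁₂ ≡ ‖ v₁ ×ᵥ v₂ ‖²
      u₁₃² : u₁₃ * u₁₃ ≡ ‖ v₁ ×ᵥ v₃ ‖²
      u₁₄² : u₁₄ * u₁₄ ≡ ‖ v₁ ×ᵥ v₄ ‖²
      u₂₃² : u₂₃ * u₂₃ ≡ ‖ v₂ ×ᵥ v₃ ‖²
      u₂₄² : u₂₄ * u₂₄ ≡ ‖ v₂ ×ᵥ v₄ ‖²
      u₃₄² : u₃₄ * u₃₄ ≡ ‖ v₃ ×ᵥ v₄ ‖²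

  open ClosedQuadrilateral

  swap₂₃ swap₃₄ negate : ClosedQuadrilateral → ClosedQuadrilateral
  swap₂₃ q = record
    { v₁ = v₁ q ; v₂ = v₃ q ; v₃ = v₂ q ; v₄ = v₄ q
    ; u₁₂ = u₁₃ q ; u₁₃ = u₁₂ q ; u₁₄ = u₁₄ q ; u₂₃ = u₂₃ q ; u₂₄ = u₃₄ q ; u₃₄ = u₂₄ q
    ; closed   = trans (cong (_+ᵥ v₄ q) (+ᵥ-swapʳ (v₁ q) (v₃ q) (v₂ q))) (closed q)
    ; balanced = trans (solve 6 (λ a b c d e f → b :+ a :+ c :+ d :+ f :+ e := a :+ b :+ c :+ d :+ e :+ f) refl
                                (u₁₂ q) (u₁₃ q) (u₁₄ q) (u₂₃ q) (u₂₄ q) (u₃₄ q)) (balanced q)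
    ; u₁₂² = u₁₃² q ; u₁₃² = u₁₂² q ; u₁₄² = u₁₄² q
    ; u₂₃² = trans (u₂₃² q) (‖×‖²-comm (v₂ q) (v₃ q)) ; u₂₄² = u₃₄² q ; u₃₄² = u₂₄² q }
  swap₃₄ q = record
    { v₁ = v₁ q ; v₂ = v₂ q ; v₃ = v₄ q ; v₄ = v₃ q
    ; u₁₂ = u₁₂ q ; u₁₃ = u₁₄ q ; u₁₄ = u₁₃ q ; u₂₃ = u₂₄ q ; u₂₄ = u₂₃ q ; u₃₄ = u₃₄ q
    ; closed   = trans (+ᵥ-swapʳ (v₁ q +ᵥ v₂ q) (v₄ q) (v₃ q)) (closed q)
    ; balanced = trans (solve 6 (λ a b c d e f → a :+ c :+ b :+ e :+ d :+ f := a :+ b :+ c :+ d :+ e :+ f) refl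
                                (u₁₂ q) (u₁₃ q) (u₁₄ q) (u₂₃ q) (u₂₄ q) (u₃₄ q)) (balanced q)
    ; u₁₂² = u₁₂² q ; u₁₃² = u₁₄² q ; u₁₄² = u₁₃² q ; u₂₃² = u₂₄² q ; u₂₄² = u₂₃² q
    ; u₃₄² = trans (u₃₄² q) (‖×‖²-comm (v₃ q) (v₄ q)) }
  negate q = record
    { v₁ = v₁ q ; v₂ = v₂ q ; v₃ = v₃ q ; v₄ = v₄ q
    ; u₁₂ = - u₁₂ q ; u₁₃ = - u₁₃ q ; u₁₄ = - u₁₄ q ; u₂₃ = - u₂₃ q ; u₂₄ = - u₂₄ q ; u₃₄ = - u₃₄ q
    ; closed   = closed q
    ; balanced = begin
        - u₁₂ q - u₁₃ q - u₁₄ q - u₂₃ q - u₂₄ q - u₃₄ q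
          ≡⟨ solve 6 (λ a b c d e f → :- a :- b :- c :- d :- e :- f := :- (a :+ b :+ c :+ d :+ e :+ f)) refl
                     (u₁₂ q) (u₁₃ q) (u₁₄ q) (u₂₃ q) (u₂₄ q) (u₃₄ q) ⟩
        - (u₁₂ q + u₁₃ q + u₁₄ q + u₂₃ q + u₂₄ q + u₃₄ q)  ≡⟨ cong (λ x → - x) (balanced q) ⟩
        - 0r                                              ≡⟨ solve 0 (:- con 0ℤ := con 0ℤ) refl ⟩
        0r                                                ∎
    ; u₁₂² = trans (neg² (u₁₂ q)) (u₁₂² q) ; u₁₃² = trans (neg² (u₁₃ q)) (u₁₃² q)
    ; u₁₄² = trans (neg² (u₁₄ q)) (u₁₄² q) ; u₂₃² = trans (neg² (u₂₃ q)) (u₂₃² q)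
    ; u₂₄² = trans (neg² (u₂₄ q)) (u₂₄² q) ; u₃₄² = trans (neg² (u₃₄ q)) (u₃₄² q) }
    where
    open ≡-Reasoning
    neg² : ∀ x → - x * - x ≡ x * x
    neg² = solve 1 (λ x → :- x :* :- x := x :* x) refl

  -- By the triangle inequality the diagonal sums v₂ × v₃ + v₄ × v₁ and v₂ × v₄ + v₃ × v₁
  -- have squared lengths at most γ² and δ², for γ = u₂₃ + u₁₄ and δ = u₂₄ + u₁₃; but these
  -- add up to 2u₁₂² + 2u₃₄², which exceeds γ² + δ² as u₁₂ + u₃₄ = −(γ + δ).
  positive-cycle : ∀ q → 0r < u₁₃ q → 0r < u₁₄ q → 0r < u₂₃ q → 0r < u₂₄ q → ⊥
  positive-cycle q 0<u₁₃ 0<u₁₄ 0<u₂₃ 0<u₂₄ =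
    ≤⇒≯ (subst (_≤ γ * γ + δ * δ) diagonals≡ (+-mono-≤ A≤γ² B≤δ²)) (squares-exceed 0<γ 0<δ sum)
    where
    open ≡-Reasoning
    γ = u₂₃ q + u₁₄ q
    δ = u₂₄ q + u₁₃ q
    0<γ = +-pos 0<u₂₃ 0<u₁₄
    0<δ = +-pos 0<u₂₄ 0<u₁₃
    A≤γ² : ‖ v₂ q ×ᵥ v₃ q +ᵥ v₄ q ×ᵥ v₁ q ‖² ≤ γ * γ
    A≤γ² = triangle 0<u₂₃ 0<u₁₄ (u₂₃² q) (trans (u₁₄² q) (‖×‖²-comm (v₁ q) (v₄ q)))
    B≤δ² : ‖ v₂ q ×ᵥ v₄ q +ᵥ v₃ q ×ᵥ v₁ q ‖² ≤ δ * δ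
    B≤δ² = triangle 0<u₂₄ 0<u₁₃ (u₂₄² q) (trans (u₁₃² q) (‖×‖²-comm (v₁ q) (v₃ q)))
    sum : u₁₂ q + u₃₄ q + γ + δ ≡ 0r
    sum = trans (solve 6 (λ a b c d e f → a :+ f :+ (d :+ c) :+ (e :+ b) := a :+ b :+ c :+ d :+ e :+ f) refl
                         (u₁₂ q) (u₁₃ q) (u₁₄ q) (u₂₃ q) (u₂₄ q) (u₃₄ q)) (balanced q)
    diagonals≡ : ‖ v₂ q ×ᵥ v₃ q +ᵥ v₄ q ×ᵥ v₁ q ‖² + ‖ v₂ q ×ᵥ v₄ q +ᵥ v₃ q ×ᵥ v₁ q ‖²
                 ≡ (u₁₂ q * u₁₂ q + u₁₂ q * u₁₂ q) + (u₃₄ q * u₃₄ q + u₃₄ q * u₃₄ q)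
    diagonals≡ = begin
      ‖ b ×ᵥ c +ᵥ v₄ q ×ᵥ a ‖² + ‖ b ×ᵥ v₄ q +ᵥ c ×ᵥ a ‖²
        ≡⟨ cong (λ w → ‖ b ×ᵥ c +ᵥ w ×ᵥ a ‖² + ‖ b ×ᵥ w +ᵥ c ×ᵥ a ‖²) v₄≡d ⟩
      ‖ b ×ᵥ c +ᵥ d ×ᵥ a ‖² + ‖ b ×ᵥ d +ᵥ c ×ᵥ a ‖²
        ≡⟨ diagonals a b c ⟩
      (‖ a ×ᵥ b ‖² + ‖ a ×ᵥ b ‖²) + (‖ c ×ᵥ d ‖² + ‖ c ×ᵥ d ‖²)
        ≡⟨ cong (λ w → (‖ a ×ᵥ b ‖² + ‖ a ×ᵥ b ‖²) + (‖ c ×ᵥ w ‖² + ‖ c ×ᵥ w ‖²)) v₄≡d ⟨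
      (‖ a ×ᵥ b ‖² + ‖ a ×ᵥ b ‖²) + (‖ c ×ᵥ v₄ q ‖² + ‖ c ×ᵥ v₄ q ‖²)
        ≡⟨ cong₂ (λ x y → (x + x) + (y + y)) (u₁₂² q) (u₃₄² q) ⟨
      (u₁₂ q * u₁₂ q + u₁₂ q * u₁₂ q) + (u₃₄ q * u₃₄ q + u₃₄ q * u₃₄ q)
        ∎
      where
      a = v₁ q ; b = v₂ q ; c = v₃ q
      d = -ᵥ (a +ᵥ b +ᵥ c)
      v₄≡d = +ᵥ-inverse-unique (closed q)

  constant-cycle : ∀ q {σ₁ σ₂ σ₃ σ₄} → HasSign σ₁ (u₁₃ q) → HasSign σ₂ (u₁₄ q) → HasSign σ₃ (u₂₃ q) →
                   HasSign σ₄ (u₂₄ q) → ¬ Constant (σ₁ ∷ σ₂ ∷ σ₃ ∷ σ₄ ∷ [])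
  constant-cycle q (positive 0<u₁₃) (positive 0<u₁₄) (positive 0<u₂₃) (positive 0<u₂₄)
                 (refl ∷ refl ∷ refl ∷ []) = positive-cycle q 0<u₁₃ 0<u₁₄ 0<u₂₃ 0<u₂₄
  constant-cycle q (negative u₁₃<0) (negative u₁₄<0) (negative u₂₃<0) (negative u₂₄<0)
                 (refl ∷ refl ∷ refl ∷ []) =
    positive-cycle (negate q) (<0⇒0<- u₁₃<0) (<0⇒0<- u₁₄<0) (<0⇒0<- u₂₃<0) (<0⇒0<- u₂₄<0)

  cycles-not-constant : ∀ q {s₁₂ s₁₃ s₁₄ s₂₃ s₂₄ s₃₄} →
    HasSign s₁₂ (u₁₂ q) → HasSign s₁₃ (u₁₃ q) → HasSign s₁₄ (u₁₄ q) →
    HasSign s₂₃ (u₂₃ q) → HasSign s₂₄ (u₂₄ q) → HasSign s₃₄ (u₃₄ q) →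
    VecAll.All (λ cycle → ¬ Constant cycle) (fourCycles (s₁₂ ∷ s₁₃ ∷ s₁₄ ∷ s₂₃ ∷ s₂₄ ∷ s₃₄ ∷ []))
  cycles-not-constant q h₁₂ h₁₃ h₁₄ h₂₃ h₂₄ h₃₄ =
    constant-cycle q h₁₃ h₁₄ h₂₃ h₂₄ ∷
    constant-cycle (swap₂₃ q) h₁₂ h₁₄ h₂₃ h₃₄ ∷
    constant-cycle (swap₂₃ (swap₃₄ q)) h₁₂ h₁₃ h₂₄ h₃₄ ∷ []

module Lines (R : RealField) where
  open import Relation.Binary.PropositionalEquality using (refl)
  open RealField R
  open RealFieldProperties R
  open Geometry R
  open Vectors R
  open V3

  moment : DLine → V3
  moment L = base L ×ᵥ dir L

  -- triple L L′ = dir L · moment L′ + dir L′ · moment L and dir L · moment L = 0.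
  triple-sum : ∀ L₁ L₂ L₃ L₄ n₁ n₂ n₃ n₄ →
    triple L₁ L₂ * (n₁ * n₂) + triple L₁ L₃ * (n₁ * n₃) + triple L₁ L₄ * (n₁ * n₄)
      + triple L₂ L₃ * (n₂ * n₃) + triple L₂ L₄ * (n₂ * n₄) + triple L₃ L₄ * (n₃ * n₄)
    ≡ (n₁ ⋆ dir L₁ +ᵥ n₂ ⋆ dir L₂ +ᵥ n₃ ⋆ dir L₃ +ᵥ n₄ ⋆ dir L₄)
      · (n₁ ⋆ moment L₁ +ᵥ n₂ ⋆ moment L₂ +ᵥ n₃ ⋆ moment L₃ +ᵥ n₄ ⋆ moment L₄)
  triple-sum L₁ L₂ L₃ L₄ n₁ n₂ n₃ n₄ =
    solve 28 (λ n₁ n₂ n₃ n₄ x₁ x₂ x₃ x₄ x₅ x₆ x₇ x₈ x₉ x₁₀ x₁₁ x₁₂ y₁ y₂ y₃ y₄ y₅ y₆ y₇ y₈ y₉ y₁₀ y₁₁ y₁₂ →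
      let X₁ = x₁ , x₂ , x₃ ; X₂ = x₄ , x₅ , x₆ ; X₃ = x₇ , x₈ , x₉ ; X₄ = x₁₀ , x₁₁ , x₁₂
          Y₁ = y₁ , y₂ , y₃ ; Y₂ = y₄ , y₅ , y₆ ; Y₃ = y₇ , y₈ , y₉ ; Y₄ = y₁₀ , y₁₁ , y₁₂
          tripleₚ = λ X Y X′ Y′ → (X ×ₚ X′) ·ₚ (Y +ₚ -ₚ Y′) in
      tripleₚ X₁ Y₁ X₂ Y₂ :* (n₁ :* n₂) :+ tripleₚ X₁ Y₁ X₃ Y₃ :* (n₁ :* n₃) :+ tripleₚ X₁ Y₁ X₄ Y₄ :* (n₁ :* n₄)
        :+ tripleₚ X₂ Y₂ X₃ Y₃ :* (n₂ :* n₃) :+ tripleₚ X₂ Y₂ X₄ Y₄ :* (n₂ :* n₄) :+ tripleₚ X₃ Y₃ X₄ Y₄ :* (n₃ :* n₄)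
      := (n₁ ⋆ₚ X₁ +ₚ n₂ ⋆ₚ X₂ +ₚ n₃ ⋆ₚ X₃ +ₚ n₄ ⋆ₚ X₄)
         ·ₚ (n₁ ⋆ₚ (Y₁ ×ₚ X₁) +ₚ n₂ ⋆ₚ (Y₂ ×ₚ X₂) +ₚ n₃ ⋆ₚ (Y₃ ×ₚ X₃) +ₚ n₄ ⋆ₚ (Y₄ ×ₚ X₄))) refl
      n₁ n₂ n₃ n₄
      (c₁ (dir L₁)) (c₂ (dir L₁)) (c₃ (dir L₁)) (c₁ (dir L₂)) (c₂ (dir L₂)) (c₃ (dir L₂))
      (c₁ (dir L₃)) (c₂ (dir L₃)) (c₃ (dir L₃)) (c₁ (dir L₄)) (c₂ (dir L₄)) (c₃ (dir L₄))
      (c₁ (base L₁)) (c₂ (base L₁)) (c₃ (base L₁)) (c₁ (base L₂)) (c₂ (base L₂)) (c₃ (base L₂))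
      (c₁ (base L₃)) (c₂ (base L₃)) (c₃ (base L₃)) (c₁ (base L₄)) (c₂ (base L₄)) (c₃ (base L₄))

module Realization (R : RealField) {n : ℕ} (L : Fin n → Geometry.DLine R)
  (nonParallel : ∀ v w → ¬ v ≡ w → ¬ Geometry.Parallel R (L v) (L w))
  (nonCoplanar : ∀ v w → ¬ v ≡ w → Geometry.NonCoplanar R (L v) (L w))
  (distance1   : ∀ v w → ¬ v ≡ w → Geometry.Distance1 R (L v) (L w)) where
  open import Data.Integer.Base using (0ℤ)
  open import Data.Vec.Relation.Unary.All as VecAll using ([]; _∷_)
  open import Relation.Binary.PropositionalEquality using (refl; sym; trans; cong; cong₂; module ≡-Reasoning)
  open ChirotopeConditions
  open RealField R
  open RealFieldProperties R
  open Geometry R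
  open Vectors R
  open ClosedQuadrilaterals R
  open Lines R
  open V3

  X : Fin n → V3
  X v = dir (L v)

  μ : Fin n → Fin n → ℝ
  μ v w = triple (L v) (L w)

  D : Triple n → ℝ
  D (i , j , k) = det (X i) (X j) (X k)

  χ : Triple n → Sign
  χ t = sign (D t)

  μ-area : ∀ {v w} s t → ¬ v ≡ w → (μ v w * (s * t)) * (μ v w * (s * t)) ≡ ‖ s ⋆ X v ×ᵥ t ⋆ X w ‖²
  μ-area {v} {w} s t v≢w = begin
    (μ v w * (s * t)) * (μ v w * (s * t))
      ≡⟨ solve 3 (λ x s t → (x :* (s :* t)) :* (x :* (s :* t)) := (s :* t) :* (s :* t) :* (x :* x)) refl (μ v w) s t ⟩
    (s * t) * (s * t) * (μ v w * μ v w)  ≡⟨ cong ((s * t) * (s * t) *_) (distance1 v w v≢w) ⟩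
    (s * t) * (s * t) * ‖ X v ×ᵥ X w ‖²  ≡⟨ ‖⋆×⋆‖² s t (X v) (X w) ⟨
    ‖ s ⋆ X v ×ᵥ t ⋆ X w ‖²              ∎
    where open ≡-Reasoning

  weighted-μ-sum : ∀ a b c d n₁ n₂ n₃ n₄ → n₁ ⋆ X a +ᵥ n₂ ⋆ X b +ᵥ n₃ ⋆ X c +ᵥ n₄ ⋆ X d ≡ 0ᵥ →
    μ a b * (n₁ * n₂) + μ a c * (n₁ * n₃) + μ a d * (n₁ * n₄)
      + μ b c * (n₂ * n₃) + μ b d * (n₂ * n₄) + μ c d * (n₃ * n₄) ≡ 0r
  weighted-μ-sum a b c d n₁ n₂ n₃ n₄ dependent =
    trans (triple-sum (L a) (L b) (L c) (L d) n₁ n₂ n₃ n₄)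
          (trans (cong (_· moments) dependent) (·-zeroˡ moments))
    where
    moments = n₁ ⋆ moment (L a) +ᵥ n₂ ⋆ moment (L b) +ᵥ n₃ ⋆ moment (L c) +ᵥ n₄ ⋆ moment (L d)

  -- The three weighted triples sum to zero and, by closed-triangle, have equal squares.
  dependent-weights : ∀ {i j k} α β γ → ¬ i ≡ j → ¬ i ≡ k → ¬ j ≡ k →
    α ⋆ X i +ᵥ β ⋆ X j +ᵥ γ ⋆ X k ≡ 0ᵥ → μ i k * (α * γ) ≡ 0r × μ j k * (β * γ) ≡ 0r
  dependent-weights {i} {j} {k} α β γ i≢j i≢k j≢k dependent =
    equal-squares-sum (trans (solve 3 (λ x y z → x :+ z :+ y := x :+ y :+ z) refl u₁ u₂ u₃) sum)
                      (trans u₁² (sym u₂²)) (trans u₃² (sym u₂²)) ,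
    equal-squares-sum sum (trans u₁² (sym u₃²)) (trans u₂² (sym u₃²))
    where
    u₁ = μ i j * (α * β)
    u₂ = μ i k * (α * γ)
    u₃ = μ j k * (β * γ)
    sum : u₁ + u₂ + u₃ ≡ 0r
    sum = trans (solve 7 (λ x y z w a b c → x :* (a :* b) :+ y :* (a :* c) :+ z :* (b :* c)
                                        := x :* (a :* b) :+ y :* (a :* c) :+ y :* (a :* con 0ℤ)
                                           :+ z :* (b :* c) :+ z :* (b :* con 0ℤ) :+ w :* (c :* con 0ℤ)) refl
                          (μ i j) (μ i k) (μ j k) (μ k k) α β γ)
                (weighted-μ-sum i j k k α β γ 0r (trans (+ᵥ-0⋆ _ (X k)) dependent))
    triangle-areas = closed-triangle (α ⋆ X i) (β ⋆ X j) (γ ⋆ X k) dependent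
    u₁² : u₁ * u₁ ≡ ‖ α ⋆ X i ×ᵥ β ⋆ X j ‖²
    u₁² = μ-area α β i≢j
    u₂² : u₂ * u₂ ≡ ‖ α ⋆ X i ×ᵥ β ⋆ X j ‖²
    u₂² = trans (μ-area α γ i≢k) (proj₁ triangle-areas)
    u₃² : u₃ * u₃ ≡ ‖ α ⋆ X i ×ᵥ β ⋆ X j ‖²
    u₃² = trans (μ-area β γ j≢k) (proj₂ triangle-areas)

  -- If xₖ lay in the plane of xᵢ and xⱼ, then ‖xᵢ × xⱼ‖² xₖ = α xᵢ + β xⱼ, and
  -- dependent-weights would force α = β = 0.
  det≢0 : ∀ {i j k} → ¬ i ≡ j → ¬ i ≡ k → ¬ j ≡ k → ¬ D (i , j , k) ≡ 0r
  det≢0 {i} {j} {k} i≢j i≢k j≢k D≡0 = γ≢0 γ≡0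
    where
    open ≡-Reasoning
    w = X i ×ᵥ X j
    α = (X k ×ᵥ X j) · w
    β = (X i ×ᵥ X k) · w
    γ = - ‖ w ‖²
    γ≢0 : ¬ γ ≡ 0r
    γ≢0 = hasSign⇒≢0 (hasSign-opposite (positive (‖‖²-pos w (nonParallel i j i≢j))))
    dependent : α ⋆ X i +ᵥ β ⋆ X j +ᵥ γ ⋆ X k ≡ 0ᵥ
    dependent = trans (dependency (X i) (X j) (X k)) (trans (cong (λ t → (- t) ⋆ w) D≡0) (-0⋆ w))
    vanishing = dependent-weights α β γ i≢j i≢k j≢k dependent
    α≡0 : α ≡ 0r
    α≡0 = *-zero-cancelˡ γ≢0 (trans (*-comm γ α) (*-zero-cancelˡ (nonCoplanar i k i≢k) (proj₁ vanishing)))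
    β≡0 : β ≡ 0r
    β≡0 = *-zero-cancelˡ γ≢0 (trans (*-comm γ β) (*-zero-cancelˡ (nonCoplanar j k j≢k) (proj₂ vanishing)))
    γ≡0 : γ ≡ 0r
    γ≡0 = begin
      γ                                         ≡⟨ *-identityʳ γ ⟨
      γ * 1r                                    ≡⟨ cong (γ *_) (unit (L k)) ⟨
      γ * (X k · X k)
        ≡⟨ solve 10 (λ a₁ a₂ a₃ b₁ b₂ b₃ c₁ c₂ c₃ g →
             let A = a₁ , a₂ , a₃ ; B = b₁ , b₂ , b₃ ; C = c₁ , c₂ , c₃ in
             g :* (C ·ₚ C) := (con 0ℤ ⋆ₚ A +ₚ con 0ℤ ⋆ₚ B +ₚ g ⋆ₚ C) ·ₚ C) refl
             (c₁ (X i)) (c₂ (X i)) (c₃ (X i)) (c₁ (X j)) (c₂ (X j)) (c₃ (X j)) (c₁ (X k)) (c₂ (X k)) (c₃ (X k)) γ ⟩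
      (0r ⋆ X i +ᵥ 0r ⋆ X j +ᵥ γ ⋆ X k) · X k  ≡⟨ cong₂ (λ a b → (a ⋆ X i +ᵥ b ⋆ X j +ᵥ γ ⋆ X k) · X k) α≡0 β≡0 ⟨
      (α ⋆ X i +ᵥ β ⋆ X j +ᵥ γ ⋆ X k) · X k    ≡⟨ cong (_· X k) dependent ⟩
      0ᵥ · X k                                  ≡⟨ ·-zeroˡ (X k) ⟩
      0r                                        ∎

  χ-hasSign : ∀ t → Distinct t → HasSign (χ t) (D t)
  χ-hasSign (i , j , k) (i≢j , i≢k , j≢k) = sign-hasSign (D (i , j , k)) (det≢0 i≢j i≢k j≢k)

  D-plückerBrackets : ∀ p a b c d e →
    Vec.map D (plückerBrackets p a b c d e) ≡ Vec.map det₃ (plückerBrackets p (X a) (X b) (X c) (X d) (X e))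
  D-plückerBrackets zero                         a b c d e = refl
  D-plückerBrackets (suc zero)                   a b c d e = refl
  D-plückerBrackets (suc (suc zero))             a b c d e = refl
  D-plückerBrackets (suc (suc (suc zero)))       a b c d e = refl
  D-plückerBrackets (suc (suc (suc (suc zero)))) a b c d e = refl

  plückerTerms-not-constant : ∀ ks → VecAll.All Distinct ks → plückerSum (Vec.map D ks) ≡ 0r →
                              ¬ Constant (plückerTerms (Vec.map χ ks))
  plückerTerms-not-constant (k₁ ∷ k₂ ∷ k₃ ∷ k₄ ∷ k₅ ∷ k₆ ∷ []) (d₁ ∷ d₂ ∷ d₃ ∷ d₄ ∷ d₅ ∷ d₆ ∷ []) relation =
    terms-not-constant (hasSign-* (χ-hasSign k₁ d₁) (χ-hasSign k₂ d₂))
                       (hasSign-opposite (hasSign-* (χ-hasSign k₃ d₃) (χ-hasSign k₄ d₄)))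
                       (hasSign-* (χ-hasSign k₅ d₅) (χ-hasSign k₆ d₆)) relation
    where
    terms-not-constant : ∀ {σ₁ σ₂ σ₃ x y z} → HasSign σ₁ x → HasSign σ₂ y → HasSign σ₃ z →
                         x + y + z ≡ 0r → ¬ Constant (σ₁ ∷ σ₂ ∷ σ₃ ∷ [])
    terms-not-constant h₁ h₂ h₃ sum (refl ∷ refl ∷ []) = hasSign⇒≢0 (hasSign-+ (hasSign-+ h₁ h₂) h₃) sum

  module _ (ε : Fin n → Fin n → Sign) (ε-hasSign : ∀ v w → ¬ v ≡ w → HasSign (ε v w) (μ v w)) where
    quadruple-satisfied : ∀ a b c d → VecAll.All Distinct (brackets (quadruple a b c d)) →
                          Satisfies ε (quadruple a b c d) (Vec.map χ (brackets (quadruple a b c d)))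
    quadruple-satisfied a b c d ((b≢c , b≢d , c≢d) ∷ (a≢c , a≢d , _) ∷ (a≢b , _ , _) ∷ _ ∷ []) =
      cycles-not-constant q (weighted a≢b h₁ h₂) (weighted a≢c h₁ h₃) (weighted a≢d h₁ h₄)
                            (weighted b≢c h₂ h₃) (weighted b≢d h₂ h₄) (weighted c≢d h₃ h₄)
      where
      n₁ = D (b , c , d)
      n₂ = - D (a , c , d)
      n₃ = D (a , b , d)
      n₄ = - D (a , b , c)
      q : ClosedQuadrilateral
      q = record
        { v₁ = n₁ ⋆ X a ; v₂ = n₂ ⋆ X b ; v₃ = n₃ ⋆ X c ; v₄ = n₄ ⋆ X d
        ; u₁₂ = μ a b * (n₁ * n₂) ; u₁₃ = μ a c * (n₁ * n₃) ; u₁₄ = μ a d * (n₁ * n₄)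
        ; u₂₃ = μ b c * (n₂ * n₃) ; u₂₄ = μ b d * (n₂ * n₄) ; u₃₄ = μ c d * (n₃ * n₄)
        ; closed   = cramer (X a) (X b) (X c) (X d)
        ; balanced = weighted-μ-sum a b c d n₁ n₂ n₃ n₄ (cramer (X a) (X b) (X c) (X d))
        ; u₁₂² = μ-area n₁ n₂ a≢b ; u₁₃² = μ-area n₁ n₃ a≢c ; u₁₄² = μ-area n₁ n₄ a≢d
        ; u₂₃² = μ-area n₂ n₃ b≢c ; u₂₄² = μ-area n₂ n₄ b≢d ; u₃₄² = μ-area n₃ n₄ c≢d }
      h₁ : HasSign (χ (b , c , d)) n₁
      h₁ = χ-hasSign _ (b≢c , b≢d , c≢d)
      h₂ : HasSign (opposite (χ (a , c , d))) n₂
      h₂ = hasSign-opposite (χ-hasSign _ (a≢c , a≢d , c≢d))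
      h₃ : HasSign (χ (a , b , d)) n₃
      h₃ = χ-hasSign _ (a≢b , a≢d , b≢d)
      h₄ : HasSign (opposite (χ (a , b , c))) n₄
      h₄ = hasSign-opposite (χ-hasSign _ (a≢b , a≢c , b≢c))
      weighted : ∀ {x y σ τ m m′} → ¬ x ≡ y → HasSign σ m → HasSign τ m′ →
                 HasSign (ε x y Sign.* (σ Sign.* τ)) (μ x y * (m * m′))
      weighted {x} {y} x≢y hσ hτ = hasSign-* (ε-hasSign x y x≢y) (hasSign-* hσ hτ)

    admissible : Admissible ε χ
    admissible (quadruple a b c d)   = quadruple-satisfied a b c d
    admissible (plücker p a b c d e) distinct = plückerTerms-not-constant (plückerBrackets p a b c d e) distinct
      (trans (cong plückerSum (D-plückerBrackets p a b c d e)) (grassmann-plücker p (X a) (X b) (X c) (X d) (X e)))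

-- A lookup table for a function on sign vectors: evaluation shares the table, so
-- each value is computed at most once however often it is looked up.
data SignTable (A : Set) : ℕ → Set where
  leaf : A → SignTable A zero
  node : ∀ {m} → (ifPlus ifMinus : SignTable A m) → SignTable A (suc m)

module _ {A : Set} where
  open import Relation.Binary.PropositionalEquality using (refl)

  tabulate : ∀ {m} → (Vec Sign m → A) → SignTable A m
  tabulate {zero}  f = leaf (f [])
  tabulate {suc m} f = node (tabulate (λ ss → f (Sign.+ ∷ ss))) (tabulate (λ ss → f (Sign.- ∷ ss)))

  lookup : ∀ {m} → SignTable A m → Vec Sign m → A
  lookup (leaf x)   []       = x
  lookup (node t _) (Sign.+ ∷ ss) = lookup t ss
  lookup (node _ t) (Sign.- ∷ ss) = lookup t ss

  lookup-tabulate : ∀ {m} (f : Vec Sign m → A) ss → lookup (tabulate f) ss ≡ f ss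
  lookup-tabulate f []       = refl
  lookup-tabulate f (Sign.+ ∷ ss) = lookup-tabulate (λ ss → f (Sign.+ ∷ ss)) ss
  lookup-tabulate f (Sign.- ∷ ss) = lookup-tabulate (λ ss → f (Sign.- ∷ ss)) ss

-- The sign at a given distance from the front (junk + beyond the end).
signAt : ℕ → List Sign → Sign
signAt _       []       = Sign.+
signAt zero    (s ∷ _)  = s
signAt (suc i) (_ ∷ ss) = signAt i ss

module Search {n : ℕ} (ε : Fin n → Fin n → Sign) where
  open import Relation.Binary.PropositionalEquality using (refl; sym; cong; cong₂; subst; module ≡-Reasoning)
  open import Data.Bool.Properties using (T-∧; T-∨)
  open import Data.Fin.Properties using (_<?_) renaming (_≟_ to _≟ᶠ_)
  open import Data.List.Base using (concatMap; filter; allFin; mapMaybe)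
  open import Data.List.Relation.Binary.Pointwise using (Pointwise; []; _∷_)
  open import Data.List.Relation.Unary.Any using (here; there)
  open import Data.Maybe.Base using (Maybe; just; nothing)
  open import Data.Product.Properties using (≡-dec)
  open import Data.Sign.Base using (+; -)
  open import Data.Vec.Relation.Unary.All as VecAll using ([]; _∷_)
  open import Function.Bundles using (Equivalence)
  open import Relation.Nullary.Decidable using (dec-true)
  open ChirotopeConditions

  _≟ₜ_ : (t u : Triple n) → Dec (t ≡ u)
  _≟ₜ_ = ≡-dec _≟ᶠ_ (≡-dec _≟ᶠ_ _≟ᶠ_)

  open import Data.List.Membership.DecPropositional _≟ₜ_ using () renaming (_∈_ to _∈ₜ_; _∈?_ to _∈ₜ?_)

  -- ss lists the signs given to the brackets ts so far, most recent first.
  Agrees : (Triple n → Sign) → List (Triple n) → List Sign → Set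
  Agrees χ = Pointwise (λ t s → χ t ≡ s)

  position : ∀ {t ts} → t ∈ₜ ts → ℕ
  position (here _)  = zero
  position (there p) = suc (position p)

  signAt-position : ∀ {χ t ts ss} → Agrees χ ts ss → (p : t ∈ₜ ts) → signAt (position p) ss ≡ χ t
  signAt-position (χt≡s ∷ _) (here refl) = sym χt≡s
  signAt-position (_ ∷ agree) (there p)  = signAt-position agree p

  record Check (ts : List (Triple n)) : Set where
    field
      fires : List Sign → Bool
      sound : ∀ {χ ss} → Agrees χ ts ss → T (fires ss) → ¬ Admissible ε χ

  data Schedule (ts : List (Triple n)) : Set where
    done : Schedule ts
    step : (t : Triple n) → List (Check (t ∷ ts)) → Schedule (t ∷ ts) → Schedule ts

  anyFires : ∀ {ts} → List (Check ts) → List Sign → Bool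
  anyFires []       ss = false
  anyFires (c ∷ cs) ss = Check.fires c ss ∨ anyFires cs ss

  anyFires-sound : ∀ {χ ts ss} (cs : List (Check ts)) → Agrees χ ts ss → T (anyFires cs ss) → ¬ Admissible ε χ
  anyFires-sound (c ∷ cs) agree fired with Equivalence.to T-∨ fired
  ... | inj₁ c-fired  = Check.sound c agree c-fired
  ... | inj₂ cs-fired = anyFires-sound cs agree cs-fired

  mutual
    refutes : ∀ {ts} → Schedule ts → List Sign → Bool
    refutes done             ss = false
    refutes (step t cs rest) ss = refutesAfter cs rest (+ ∷ ss) ∧ refutesAfter cs rest (- ∷ ss)

    refutesAfter : ∀ {ts} → List (Check ts) → Schedule ts → List Sign → Bool
    refutesAfter cs rest ss = anyFires cs ss ∨ refutes rest ss

  mutual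
    refutes-sound : ∀ {χ ts ss} (sch : Schedule ts) → Agrees χ ts ss → T (refutes sch ss) → ¬ Admissible ε χ
    refutes-sound {χ} (step t cs rest) agree r = refutesAfter-sound cs rest (refl ∷ agree) (branch (χ t) r)
      where
      branch : ∀ s {ss} → T (refutesAfter cs rest (+ ∷ ss) ∧ refutesAfter cs rest (- ∷ ss)) →
               T (refutesAfter cs rest (s ∷ ss))
      branch + r = proj₁ (Equivalence.to T-∧ r)
      branch - r = proj₂ (Equivalence.to T-∧ r)

    refutesAfter-sound : ∀ {χ ts ss} (cs : List (Check ts)) (rest : Schedule ts) → Agrees χ ts ss →
                         T (refutesAfter cs rest ss) → ¬ Admissible ε χ
    refutesAfter-sound cs rest agree r with Equivalence.to T-∨ r
    ... | inj₁ fired   = anyFires-sound cs agree fired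
    ... | inj₂ refuted = refutes-sound rest agree refuted

  positions : ∀ {m ts} {bs : Vec (Triple n) m} → VecAll.All (_∈ₜ ts) bs → Vec ℕ m
  positions []       = []
  positions (p ∷ ps) = position p ∷ positions ps

  signsAt-positions : ∀ {χ m ts ss} {bs : Vec (Triple n) m} → Agrees χ ts ss → (ps : VecAll.All (_∈ₜ ts) bs) →
                      Vec.map (λ i → signAt i ss) (positions ps) ≡ Vec.map χ bs
  signsAt-positions agree []       = refl
  signsAt-positions agree (p ∷ ps) = cong₂ _∷_ (signAt-position agree p) (signsAt-positions agree ps)

  firesWith : ∀ {m} → SignTable Bool m → Vec ℕ m → List Sign → Bool
  firesWith table is ss = not (lookup table (Vec.map (λ i → signAt i ss) is))

  -- Taking the table and positions as arguments makes evaluation share them between runs.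
  mkCheck : ∀ {ts m} (table : SignTable Bool m) (is : Vec ℕ m) →
            (∀ {χ ss} → Agrees χ ts ss → T (firesWith table is ss) → ¬ Admissible ε χ) → Check ts
  mkCheck table is sound = record { fires = firesWith table is ; sound = sound }

  check : ∀ ts (c : Constraint n) → VecAll.All Distinct (brackets c) → VecAll.All (_∈ₜ ts) (brackets c) →
          Check ts
  check ts c distinct found = mkCheck (tabulate verdict) (positions found) sound
    where
    verdict : Vec Sign (arity c) → Bool
    verdict χs = does (satisfies? ε c χs)
    sound : ∀ {χ ss} → Agrees χ ts ss → T (firesWith (tabulate verdict) (positions found) ss) → ¬ Admissible ε χ
    sound {χ} {ss} agree fired admissible = subst (λ b → T (not b)) satisfied fired
      where
      open ≡-Reasoning
      satisfied : lookup (tabulate verdict) (Vec.map (λ i → signAt i ss) (positions found)) ≡ true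
      satisfied = begin
        lookup (tabulate verdict) (Vec.map (λ i → signAt i ss) (positions found))
          ≡⟨ cong (lookup (tabulate verdict)) (signsAt-positions agree found) ⟩
        lookup (tabulate verdict) (Vec.map χ (brackets c))
          ≡⟨ lookup-tabulate verdict (Vec.map χ (brackets c)) ⟩
        does (satisfies? ε c (Vec.map χ (brackets c)))
          ≡⟨ dec-true (satisfies? ε c _) (admissible c distinct) ⟩
        true
          ∎

  below : Fin n → List (Fin n)
  below t = filter (_<? t) (allFin n)

  between : Fin n → Fin n → List (Fin n)
  between s t = filter (λ x → (s <? x) ×-dec (x <? t)) (allFin n)

  -- For brackets enumerated in colexicographic order, the constraints on sorted
  -- tuples whose last bracket is (i , j , t).
  constraintsEndingAt : Triple n → List (Constraint n)
  constraintsEndingAt (i , j , t) =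
    List.map (λ a → quadruple a i j t) (below i) ++
    concatMap (λ b → List.map (λ c → plücker zero i b c j t) (between b j)) (between i j) ++
    concatMap (λ a → List.map (λ c → plücker (suc zero) a i c j t) (between i j)) (below i) ++
    concatMap (λ a → concatMap (λ b → List.map (λ p → plücker p a b i j t) pivots₃₄₅) (between a i)) (below i)
    where
    pivots₃₄₅ : List (Fin 5)
    pivots₃₄₅ = suc (suc zero) ∷ suc (suc (suc zero)) ∷ suc (suc (suc (suc zero))) ∷ []

  certify : ∀ ts → Constraint n → Maybe (Check ts)
  certify ts c with VecAll.all? distinct? (brackets c) | VecAll.all? (_∈ₜ? ts) (brackets c)
  ... | yes distinct | yes found = just (check ts c distinct found)
  ... | _            | _         = nothing

  colex : List (Triple n)
  colex = concatMap (λ t → concatMap (λ j → List.map (λ i → i , j , t) (below j)) (below t)) (allFin n)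

  scheduleFrom : ∀ ts → List (Triple n) → Schedule ts
  scheduleFrom ts []        = done
  scheduleFrom ts (t ∷ ts′) =
    step t (mapMaybe (certify (t ∷ ts)) (constraintsEndingAt t)) (scheduleFrom (t ∷ ts) ts′)

  schedule : Schedule []
  schedule = scheduleFrom [] colex

  refutes-schedule-sound : T (refutes schedule []) → ∀ χ → ¬ Admissible ε χ
  refutes-schedule-sound r χ = refutes-sound schedule [] r


edgeSign : ∀ {n} → (Fin n → Fin n → Bool) → Fin n → Fin n → Sign
edgeSign adj v w = if adj v w then Sign.+ else Sign.-

not-realizable : ∀ {n} (adj : Fin n → Fin n → Bool) →
                 T (Search.refutes (edgeSign adj) (Search.schedule (edgeSign adj)) []) →
                 (R : RealField) → ¬ Realizable R n adj
not-realizable adj refuted R (L , nonParallel , nonCoplanar , distance1 , chirality) =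
  Search.refutes-schedule-sound (edgeSign adj) refuted χ (admissible (edgeSign adj) edge-hasSign)
  where
  open import Function.Bundles using (Equivalence)
  open import Relation.Binary.PropositionalEquality using (sym; trans)
  open RealField R
  open RealFieldProperties R using (HasSign; positive; negative)
  open Realization R L nonParallel nonCoplanar distance1
  edge-hasSign : ∀ v w → ¬ v ≡ w → HasSign (edgeSign adj v w) (μ v w)
  edge-hasSign v w v≢w with adj v w in eq | <-tri (μ v w) 0r
  ... | true  | _                = positive (Equivalence.from (chirality v w v≢w) eq)
  ... | false | inj₁ μ<0         = negative μ<0
  ... | false | inj₂ (inj₁ μ≡0)  = contradiction μ≡0 (nonCoplanar v w v≢w)
  ... | false | inj₂ (inj₂ 0<μ) with () ← trans (sym (Equivalence.to (chirality v w v≢w) 0<μ)) eq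

theorem2 : (R : RealField) →
    ¬ Realizable R 5 K5 × ¬ Realizable R 5 K32 × ¬ Realizable R 7 K7∖C5
      × ¬ Realizable R 7 K7∖H6 × ¬ Realizable R 8 K8∖H7
theorem2 R = not-realizable K5 _ R , not-realizable K32 _ R , not-realizable K7∖C5 _ R
           , not-realizable K7∖H6 _ R , not-realizable K8∖H7 _ R
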